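{- Let $P(x)=\sqrt{1-10x+9x^2}$. Then, as formal power series in $x$ whose coefficients are Laurent polynomials in $y$ (rational functions being expanded in powers of $x$), $$\sum_{n\ge0}\sum_{m\in\mathbb{Z}}A^{H}_{R}(n,m)x^ny^m=\frac{y^2}{y^2-x(1+y+y^2)^2},\qquad \sum_{n\ge0}\sum_{m\in\mathbb{Z}}A^{H}(n,m)x^ny^m=\frac{y(1+y+y^2)}{y^2-x(1+y+y^2)^2},$$ $$\sum_{n\ge0}A^{H}_{R}(n,0)x^n=\frac{1}{P(x)}\sqrt{\frac{1-3x+P(x)}{2}},\qquad \sum_{n\ge0}A^{H}(n,0)x^n=\frac{1}{P(x)}\sqrt{\frac{1-3x-P(x)}{2x}}.$$
   Context: A lattice path is a finite sequence of steps (vectors in $\mathbb{Z}^2$) starting at $(0,0)$; its vertices are the partial sums, and it terminates at the last vertex (the empty path terminates at $(0,0)$). Let $S_{M}=\{(1,0),(1,1),(1,-1)\}$ and $S_{MW}=S_M\cup\{(0,1),(0,-1)\}$; $(0,\pm1)$ are vertical steps. A vertically constrained $S_{MW}$ path is a lattice path with steps in $S_{MW}$ with no two consecutive vertical steps. $A^{H}(n,m)$ is the number of vertically constrained $S_{MW}$ paths from $(0,0)$ to $(n,m)$, and $A^{H}_{R}(n,m)$ is the number of those whose first step (if any) lies in $S_M$. -}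

module Defs where

open import Data.Bool using (Bool; true; false; not; _∧_; if_then_else_)
open import Data.Nat as ℕ using (ℕ; zero; suc; _≤ᵇ_; _≡ᵇ_; _∸_)
open import Data.Integer as ℤ using (ℤ; +_)
open import Data.Rational as ℚ using (ℚ; 0ℚ; 1ℚ; ½)
open import Data.List using (List; []; _∷_; _++_; map; concatMap; filterᵇ; length; foldr; upTo)
open import Data.Product using (_×_; _,_)
open import Relation.Nullary.Decidable using (⌊_⌋)

data Step : Set where
  E NE SE N S : Step

allSteps : List Step
allSteps = E ∷ NE ∷ SE ∷ N ∷ S ∷ []

vertical : Step → Bool
vertical N = true
vertical S = true
vertical _ = false

dx : Step → ℕ
dx s = if vertical s then 0 else 1

dy : Step → ℤ
dy E  = + 0
dy NE = + 1
dy SE = ℤ.- (+ 1)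
dy N  = + 1
dy S  = ℤ.- (+ 1)

Path : Set
Path = List Step

endX : Path → ℕ
endX = foldr (λ s r → dx s ℕ.+ r) 0

endY : Path → ℤ
endY = foldr (λ s r → dy s ℤ.+ r) (+ 0)

vConstrained : Path → Bool
vConstrained []            = true
vConstrained (s ∷ [])      = true
vConstrained (s ∷ t ∷ p)   = not (vertical s ∧ vertical t) ∧ vConstrained (t ∷ p)

firstInSM : Path → Bool
firstInSM []      = true
firstInSM (s ∷ _) = not (vertical s)

pathsOfLength : ℕ → List Path
pathsOfLength zero    = [] ∷ []
pathsOfLength (suc k) = concatMap (λ s → map (s ∷_) (pathsOfLength k)) allSteps

endsAt : ℕ → ℤ → Path → Bool
endsAt n m p = (endX p ≡ᵇ n) ∧ ⌊ endY p ℤ.≟ m ⌋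

countLen : (Path → Bool) → List ℕ → ℕ
countLen P = foldr (λ l r → length (filterᵇ P (pathsOfLength l)) ℕ.+ r) 0

-- A path ending at abscissa n has exactly n steps from S_M and, having no
-- two consecutive vertical steps, at most n+1 vertical steps; so every
-- path ending at (n,m) has length ≤ 2n+1 and this count is exhaustive.
countPaths : ℕ → (Path → Bool) → ℕ
countPaths n P = countLen P (upTo (suc (2 ℕ.* n ℕ.+ 1)))

AH : ℕ → ℤ → ℕ
AH n m = countPaths n (λ p → vConstrained p ∧ endsAt n m p)

AHR : ℕ → ℤ → ℕ
AHR n m = countPaths n (λ p → vConstrained p ∧ firstInSM p ∧ endsAt n m p)

-- Formal power series in x with coefficients Laurent series/polynomials
-- in y:  G n m = [x^n y^m] G.

BiSeries : Set
BiSeries = ℕ → ℤ → ℤ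

-- polynomials in x, y, y⁻¹ : finite lists of terms (i , j , c) = c x^i y^j
Poly : Set
Poly = List (ℕ × ℤ × ℤ)

mono : ℕ → ℤ → ℤ → Poly
mono i j c = (i , j , c) ∷ []

_⊕_ : Poly → Poly → Poly
p ⊕ q = p ++ q

⊝_ : Poly → Poly
⊝ p = map (λ { (i , j , c) → (i , j , ℤ.- c) }) p

_⊗_ : Poly → Poly → Poly
p ⊗ q = concatMap (λ { (i , j , c) → map (λ { (i' , j' , c') → (i ℕ.+ i' , j ℤ.+ j' , c ℤ.* c') }) q }) p

coeffP : Poly → ℕ → ℤ → ℤ
coeffP p n m = foldr (λ { (i , j , c) r → (if (i ≡ᵇ n) ∧ ⌊ j ℤ.≟ m ⌋ then c else + 0) ℤ.+ r }) (+ 0) p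

_⊛_ : Poly → BiSeries → BiSeries
(p ⊛ G) n m = foldr (λ { (i , j , c) r → (if i ≤ᵇ n then c ℤ.* G (n ∸ i) (m ℤ.- j) else + 0) ℤ.+ r }) (+ 0) p

Q : Poly
Q = mono 0 (+ 0) (+ 1) ⊕ (mono 0 (+ 1) (+ 1) ⊕ mono 0 (+ 2) (+ 1))

Den : Poly
Den = mono 0 (+ 2) (+ 1) ⊕ (⊝ (mono 1 (+ 0) (+ 1) ⊗ (Q ⊗ Q)))

NumR : Poly
NumR = mono 0 (+ 2) (+ 1)

NumA : Poly
NumA = mono 0 (+ 1) (+ 1) ⊗ Q

Series : Set
Series = ℕ → ℚ

Σℚ : List ℕ → (ℕ → ℚ) → ℚ
Σℚ l f = foldr (λ i r → f i ℚ.+ r) 0ℚ l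

_+ₛ_ : Series → Series → Series
(f +ₛ g) n = f n ℚ.+ g n

_-ₛ_ : Series → Series → Series
(f -ₛ g) n = f n ℚ.- g n

_*ₛ_ : Series → Series → Series
(f *ₛ g) n = Σℚ (upTo (suc n)) (λ i → f i ℚ.* g (n ∸ i))

scaleₛ : ℚ → Series → Series
scaleₛ c f n = c ℚ.* f n

-- division by x (meaningful for series with zero constant term)
divX : Series → Series
divX f n = f (suc n)

polyₛ : List ℚ → Series
polyₛ []       n       = 0ℚ
polyₛ (c ∷ cs) zero    = c
polyₛ (c ∷ cs) (suc n) = polyₛ cs n

ℚof : ℤ → ℚ
ℚof z = z ℚ./ 1

at : List ℚ → ℕ → ℚ
at []       _       = 0ℚ
at (c ∷ cs) zero    = c
at (c ∷ cs) (suc n) = at cs n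

-- coefficients s₀ … sₙ of the square root (with s₀ = 1) of a series f
-- with constant term 1:  s₀ = 1,  sₙ = (fₙ - Σ_{i=1}^{n-1} sᵢ s_{n-i}) / 2
sqrtList : Series → ℕ → List ℚ
sqrtList f zero    = 1ℚ ∷ []
sqrtList f (suc n) = let s = sqrtList f n in
  s ++ ((f (suc n) ℚ.- Σℚ (upTo (suc n)) (λ i → if i ≡ᵇ 0 then 0ℚ else at s i ℚ.* at s (suc n ∸ i))) ℚ.* ½ ∷ [])

sqrtₛ : Series → Series
sqrtₛ f n = at (sqrtList f n) n

-- coefficients b₀ … bₙ of the inverse of a series f with constant term 1:
-- b₀ = 1,  bₙ = - Σ_{i=1}^{n} fᵢ b_{n-i}
invList : Series → ℕ → List ℚ
invList f zero    = 1ℚ ∷ []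
invList f (suc n) = let b = invList f n in
  b ++ (ℚ.- Σℚ (upTo (suc n)) (λ i → f (suc i) ℚ.* at b (n ∸ i)) ∷ [])

invₛ : Series → Series
invₛ f n = at (invList f n) n

Pₛ : Series
Pₛ = sqrtₛ (polyₛ (1ℚ ∷ ℚof (ℤ.- (+ 10)) ∷ ℚof (+ 9) ∷ []))

one-3x : Series
one-3x = polyₛ (1ℚ ∷ ℚof (ℤ.- (+ 3)) ∷ [])

GFR0 : Series
GFR0 = invₛ Pₛ *ₛ sqrtₛ (scaleₛ ½ (one-3x +ₛ Pₛ))

GFA0 : Series
GFA0 = invₛ Pₛ *ₛ sqrtₛ (scaleₛ ½ (divX (one-3x -ₛ Pₛ)))

module Submission where

-- Call a vertically constrained path restricted if its first step lies in S_M.  A restricted path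
-- to abscissa n + 1 is a step of S_M followed by an arbitrary path to abscissa n, and an arbitrary
-- path is a restricted one, possibly preceded by a vertical step; each time the ordinate changes
-- by -1, 0 or 1.  Hence A^H_R(n, m) and A^H(n, m) are the trinomial coefficients [yᵐ] (y⁻¹ + 1 + y)ᵏ
-- with k = 2n and k = 2n + 1, which gives the two rational generating functions.
--
-- For m = 0 these are the central trinomial coefficients Tₖ.  Their recurrence makes
-- 𝕋(t) = ∑ Tₖ tᵏ satisfy (1 - 2t - 3t²) 𝕋′ = (1 + 3t) 𝕋, whence 𝕋² (1 - 2t - 3t²) = 1.  Writing
-- 𝕋(t) = 𝔼(t²) + t 𝕆(t²) and comparing even and odd parts, α = (P 𝔼)² and β = x (P 𝕆)² satisfy
-- α + β = 1 - 3x and α β = x, so α - β = ±P and α, β = (1 - 3x ± P) / 2; the constant terms fix the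
-- sign, and 𝔼, 𝕆 are recovered by a square root and a division by P.

open import Defs
open import Algebra.Bundles using (CommutativeRing; CommutativeMonoid)
import Algebra.Properties.CommutativeSemigroup as CommSemigroupProperties
import Algebra.Solver.Ring as RingSolver
import Algebra.Solver.Ring.AlmostCommutativeRing as ACR
open import Data.Bool using (Bool; true; false; _∧_; if_then_else_)
import Data.Bool.Properties as Boolₚ
open import Data.Integer as ℤ using (ℤ; +_; -[1+_])
import Data.Integer.Properties as ℤₚ
import Data.Integer.Solver as ℤ-Solver
open import Data.List using (List; []; _∷_; _++_; map; filterᵇ; length; upTo; applyUpTo)
open import Data.List.Properties using (length-++; filter-++)
open import Data.Maybe using (Maybe; just; nothing)
open import Data.Nat as ℕ using (ℕ; zero; suc; _∸_; _≤_; _<_; z≤n; s≤s; _≡ᵇ_)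
import Data.Nat.Coprimality as Coprime
import Data.Nat.Properties as ℕₚ
import Data.Nat.Solver as ℕ-Solver
open import Data.Product using (_×_; _,_; Σ-syntax)
open import Data.Rational using (ℚ; mkℚ; 0ℚ; 1ℚ; ½; _+_; _*_; -_; _-_; _/_; 1/_)
import Data.Rational.Properties as ℚₚ
open import Data.Rational.Solver using (module +-*-Solver)
open import Data.Sum using (inj₁; inj₂)
open import Function using (_∘_)
open import Function.Bundles using (mk⇔)
open import Relation.Binary.PropositionalEquality using (_≡_; _≗_; refl; sym; trans; cong; cong₂; subst; module ≡-Reasoning)
open import Relation.Nullary using (yes; no)
open import Relation.Nullary.Decidable using (⌊_⌋; T?; does-⇔; isYes≗does)
open CommSemigroupProperties (CommutativeMonoid.commutativeSemigroup ℚₚ.+-0-commutativeMonoid)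
  using () renaming (interchange to +-interchange)

-- Formal power series over ℚ

∑ : (ℕ → ℚ) → ℕ → ℚ
∑ f zero    = 0ℚ
∑ f (suc n) = f 0 + ∑ (f ∘ suc) n

Σℚ-applyUpTo : ∀ (g : ℕ → ℕ) (f : ℕ → ℚ) n → Σℚ (applyUpTo g n) f ≡ ∑ (f ∘ g) n
Σℚ-applyUpTo g f zero    = refl
Σℚ-applyUpTo g f (suc n) = cong (_+_ (f (g 0))) (Σℚ-applyUpTo (g ∘ suc) f n)

Σℚ-upTo : ∀ (f : ℕ → ℚ) n → Σℚ (upTo n) f ≡ ∑ f n
Σℚ-upTo = Σℚ-applyUpTo (λ i → i)

∑-cong< : ∀ {f g : ℕ → ℚ} n → (∀ i → i < n → f i ≡ g i) → ∑ f n ≡ ∑ g n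
∑-cong< zero    eq = refl
∑-cong< (suc n) eq = cong₂ _+_ (eq 0 (s≤s z≤n)) (∑-cong< n (λ i i<n → eq (suc i) (s≤s i<n)))

∑-cong : ∀ {f g : ℕ → ℚ} n → (∀ i → f i ≡ g i) → ∑ f n ≡ ∑ g n
∑-cong n eq = ∑-cong< n (λ i _ → eq i)

∑-zero : ∀ {f : ℕ → ℚ} n → (∀ i → i < n → f i ≡ 0ℚ) → ∑ f n ≡ 0ℚ
∑-zero zero    eq = refl
∑-zero (suc n) eq = trans (cong₂ _+_ (eq 0 (s≤s z≤n)) (∑-zero n (λ i i<n → eq (suc i) (s≤s i<n))))
                          (ℚₚ.+-identityˡ 0ℚ)

∑-+ : ∀ (f g : ℕ → ℚ) n → ∑ (λ i → f i + g i) n ≡ ∑ f n + ∑ g n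
∑-+ f g zero    = refl
∑-+ f g (suc n) = trans (cong (_+_ (f 0 + g 0)) (∑-+ (f ∘ suc) (g ∘ suc) n))
                        (+-interchange (f 0) (g 0) _ _)

∑-*ˡ : ∀ c (f : ℕ → ℚ) n → c * ∑ f n ≡ ∑ (λ i → c * f i) n
∑-*ˡ c f zero    = ℚₚ.*-zeroʳ c
∑-*ˡ c f (suc n) = trans (ℚₚ.*-distribˡ-+ c (f 0) _) (cong (_+_ (c * f 0)) (∑-*ˡ c (f ∘ suc) n))

∑-*ʳ : ∀ c (f : ℕ → ℚ) n → ∑ f n * c ≡ ∑ (λ i → f i * c) n
∑-*ʳ c f n = trans (ℚₚ.*-comm _ c) (trans (∑-*ˡ c f n) (∑-cong n (λ i → ℚₚ.*-comm c (f i))))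

∑-last : ∀ (f : ℕ → ℚ) n → ∑ f (suc n) ≡ ∑ f n + f n
∑-last f zero    = trans (ℚₚ.+-identityʳ (f 0)) (sym (ℚₚ.+-identityˡ (f 0)))
∑-last f (suc n) = trans (cong (_+_ (f 0)) (∑-last (f ∘ suc) n)) (sym (ℚₚ.+-assoc (f 0) _ (f (suc n))))

∑-reverse : ∀ (f : ℕ → ℚ) n → ∑ f (suc n) ≡ ∑ (λ i → f (n ∸ i)) (suc n)
∑-reverse f zero    = refl
∑-reverse f (suc n) = begin
  f 0 + ∑ (f ∘ suc) (suc n)                    ≡⟨ cong (_+_ (f 0)) (∑-reverse (f ∘ suc) n) ⟩
  f 0 + ∑ (λ i → f (suc (n ∸ i))) (suc n)      ≡⟨ ℚₚ.+-comm (f 0) _ ⟩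
  ∑ (λ i → f (suc (n ∸ i))) (suc n) + f 0      ≡⟨ cong₂ _+_ (∑-cong< (suc n) (λ i i≤n → cong f (sym (ℕₚ.+-∸-assoc 1 (ℕₚ.≤-pred i≤n)))))
                                                            (cong f (sym (ℕₚ.n∸n≡0 (suc n)))) ⟩
  ∑ (λ i → f (suc n ∸ i)) (suc n) + f (suc n ∸ suc n) ≡⟨ sym (∑-last (λ i → f (suc n ∸ i)) (suc n)) ⟩
  ∑ (λ i → f (suc n ∸ i)) (suc (suc n))        ∎
  where open ≡-Reasoning

∑-swap : ∀ (f : ℕ → ℕ → ℚ) n m → ∑ (λ i → ∑ (f i) m) n ≡ ∑ (λ j → ∑ (λ i → f i j) n) m
∑-swap f zero    m = sym (∑-zero m (λ _ _ → refl))
∑-swap f (suc n) m = trans (cong (_+_ (∑ (f 0) m)) (∑-swap (f ∘ suc) n m)) (sym (∑-+ (f 0) _ m))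

-- Truncation that turns the triangular double sum in *ₛ-assoc into a square one, which can be swapped.
[_≤_]_ : ℕ → ℕ → ℚ → ℚ
[ zero  ≤ k     ] x = x
[ suc i ≤ zero  ] x = 0ℚ
[ suc i ≤ suc k ] x = [ i ≤ k ] x

[≤]-*ˡ : ∀ i k c x → c * [ i ≤ k ] x ≡ [ i ≤ k ] (c * x)
[≤]-*ˡ zero    k       c x = refl
[≤]-*ˡ (suc i) zero    c x = ℚₚ.*-zeroʳ c
[≤]-*ˡ (suc i) (suc k) c x = [≤]-*ˡ i k c x

[≤]-*ʳ : ∀ i k c x → [ i ≤ k ] x * c ≡ [ i ≤ k ] (x * c)
[≤]-*ʳ i k c x = trans (ℚₚ.*-comm _ c) (trans ([≤]-*ˡ i k c x) (cong ([ i ≤ k ]_) (ℚₚ.*-comm c x)))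

∑-[≤]-below : ∀ (g : ℕ → ℚ) k n → k ≤ n → ∑ (λ i → [ i ≤ k ] g i) (suc n) ≡ ∑ g (suc k)
∑-[≤]-below g zero    zero    z≤n = refl
∑-[≤]-below g zero    (suc n) z≤n = cong (_+_ (g 0)) (∑-zero (suc n) (λ _ _ → refl))
∑-[≤]-below g (suc k) (suc n) (s≤s k≤n) = cong (_+_ (g 0)) (∑-[≤]-below (g ∘ suc) k n k≤n)

∑-[≤]-above : ∀ (h : ℕ → ℚ) i d → ∑ (λ k → [ i ≤ k ] h k) (i ℕ.+ d) ≡ ∑ (λ j → h (i ℕ.+ j)) d
∑-[≤]-above h zero    d = refl
∑-[≤]-above h (suc i) d = trans (ℚₚ.+-identityˡ _) (∑-[≤]-above (h ∘ suc) i d)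

0ₛ 1ₛ Xₛ : Series
0ₛ _ = 0ℚ
1ₛ   = polyₛ (1ℚ ∷ [])
Xₛ   = polyₛ (0ℚ ∷ 1ℚ ∷ [])

constₛ : ℚ → Series
constₛ c = polyₛ (c ∷ [])

-ₛ_ : Series → Series
(-ₛ f) n = - f n

*ₛ-coeff : ∀ (f g : Series) n → (f *ₛ g) n ≡ ∑ (λ i → f i * g (n ∸ i)) (suc n)
*ₛ-coeff f g n = Σℚ-upTo (λ i → f i * g (n ∸ i)) (suc n)

*ₛ-cong : ∀ {f f′ g g′} → f ≗ f′ → g ≗ g′ → (f *ₛ g) ≗ (f′ *ₛ g′)
*ₛ-cong {f} {f′} {g} {g′} f≗f′ g≗g′ n = begin
  (f *ₛ g) n                               ≡⟨ *ₛ-coeff f g n ⟩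
  ∑ (λ i → f i * g (n ∸ i)) (suc n)        ≡⟨ ∑-cong (suc n) (λ i → cong₂ _*_ (f≗f′ i) (g≗g′ (n ∸ i))) ⟩
  ∑ (λ i → f′ i * g′ (n ∸ i)) (suc n)      ≡⟨ sym (*ₛ-coeff f′ g′ n) ⟩
  (f′ *ₛ g′) n                             ∎
  where open ≡-Reasoning

*ₛ-comm : ∀ f g → (f *ₛ g) ≗ (g *ₛ f)
*ₛ-comm f g n = begin
  (f *ₛ g) n                                          ≡⟨ *ₛ-coeff f g n ⟩
  ∑ (λ i → f i * g (n ∸ i)) (suc n)                   ≡⟨ ∑-reverse (λ i → f i * g (n ∸ i)) n ⟩
  ∑ (λ i → f (n ∸ i) * g (n ∸ (n ∸ i))) (suc n)       ≡⟨ ∑-cong< (suc n) swap ⟩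
  ∑ (λ i → g i * f (n ∸ i)) (suc n)                   ≡⟨ sym (*ₛ-coeff g f n) ⟩
  (g *ₛ f) n                                          ∎
  where
  open ≡-Reasoning
  swap : ∀ i → i < suc n → f (n ∸ i) * g (n ∸ (n ∸ i)) ≡ g i * f (n ∸ i)
  swap i i≤n = trans (ℚₚ.*-comm (f (n ∸ i)) (g (n ∸ (n ∸ i)))) (cong (λ j → g j * f (n ∸ i)) (ℕₚ.m∸[m∸n]≡n (ℕₚ.≤-pred i≤n)))

*ₛ-distribˡ : ∀ f g h → (f *ₛ (g +ₛ h)) ≗ ((f *ₛ g) +ₛ (f *ₛ h))
*ₛ-distribˡ f g h n = begin
  (f *ₛ (g +ₛ h)) n                                                  ≡⟨ *ₛ-coeff f (g +ₛ h) n ⟩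
  ∑ (λ i → f i * (g (n ∸ i) + h (n ∸ i))) (suc n)                    ≡⟨ ∑-cong (suc n) (λ i → ℚₚ.*-distribˡ-+ (f i) (g (n ∸ i)) (h (n ∸ i))) ⟩
  ∑ (λ i → f i * g (n ∸ i) + f i * h (n ∸ i)) (suc n)                ≡⟨ ∑-+ (λ i → f i * g (n ∸ i)) (λ i → f i * h (n ∸ i)) (suc n) ⟩
  ∑ (λ i → f i * g (n ∸ i)) (suc n) + ∑ (λ i → f i * h (n ∸ i)) (suc n) ≡⟨ sym (cong₂ _+_ (*ₛ-coeff f g n) (*ₛ-coeff f h n)) ⟩
  ((f *ₛ g) +ₛ (f *ₛ h)) n                                           ∎
  where open ≡-Reasoning

*ₛ-distribʳ : ∀ f g h → ((g +ₛ h) *ₛ f) ≗ ((g *ₛ f) +ₛ (h *ₛ f))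
*ₛ-distribʳ f g h n = begin
  ((g +ₛ h) *ₛ f) n                ≡⟨ *ₛ-comm (g +ₛ h) f n ⟩
  (f *ₛ (g +ₛ h)) n                ≡⟨ *ₛ-distribˡ f g h n ⟩
  (f *ₛ g) n + (f *ₛ h) n          ≡⟨ cong₂ _+_ (*ₛ-comm f g n) (*ₛ-comm f h n) ⟩
  ((g *ₛ f) +ₛ (h *ₛ f)) n         ∎
  where open ≡-Reasoning

*ₛ-identityˡ : ∀ f → (1ₛ *ₛ f) ≗ f
*ₛ-identityˡ f n = begin
  (1ₛ *ₛ f) n                                  ≡⟨ *ₛ-coeff 1ₛ f n ⟩
  1ℚ * f n + ∑ (λ i → 0ℚ * f (n ∸ suc i)) n    ≡⟨ cong₂ _+_ (ℚₚ.*-identityˡ (f n)) (∑-zero n (λ i _ → ℚₚ.*-zeroˡ (f (n ∸ suc i)))) ⟩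
  f n + 0ℚ                                     ≡⟨ ℚₚ.+-identityʳ (f n) ⟩
  f n                                          ∎
  where open ≡-Reasoning

*ₛ-assoc : ∀ a b c → ((a *ₛ b) *ₛ c) ≗ (a *ₛ (b *ₛ c))
*ₛ-assoc a b c n = begin
  ((a *ₛ b) *ₛ c) n
    ≡⟨ *ₛ-coeff (a *ₛ b) c n ⟩
  ∑ (λ k → (a *ₛ b) k * c (n ∸ k)) (suc n)
    ≡⟨ ∑-cong< (suc n) (λ k k≤n → cong (_* c (n ∸ k)) (trans (*ₛ-coeff a b k)
                                     (sym (∑-[≤]-below (λ i → a i * b (k ∸ i)) k n (ℕₚ.≤-pred k≤n))))) ⟩
  ∑ (λ k → ∑ (λ i → [ i ≤ k ] (a i * b (k ∸ i))) (suc n) * c (n ∸ k)) (suc n)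
    ≡⟨ ∑-cong (suc n) (λ k → trans (∑-*ʳ (c (n ∸ k)) (λ i → [ i ≤ k ] (a i * b (k ∸ i))) (suc n))
                                   (∑-cong (suc n) (λ i → [≤]-*ʳ i k (c (n ∸ k)) (a i * b (k ∸ i))))) ⟩
  ∑ (λ k → ∑ (λ i → [ i ≤ k ] (a i * b (k ∸ i) * c (n ∸ k))) (suc n)) (suc n)
    ≡⟨ ∑-swap (λ k i → [ i ≤ k ] (a i * b (k ∸ i) * c (n ∸ k))) (suc n) (suc n) ⟩
  ∑ (λ i → ∑ (λ k → [ i ≤ k ] (a i * b (k ∸ i) * c (n ∸ k))) (suc n)) (suc n)
    ≡⟨ ∑-cong< (suc n) (λ i i≤n → inner i (ℕₚ.≤-pred i≤n)) ⟩
  ∑ (λ i → a i * (b *ₛ c) (n ∸ i)) (suc n)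
    ≡⟨ sym (*ₛ-coeff a (b *ₛ c) n) ⟩
  (a *ₛ (b *ₛ c)) n
    ∎
  where
  open ≡-Reasoning
  inner : ∀ i → i ≤ n → ∑ (λ k → [ i ≤ k ] (a i * b (k ∸ i) * c (n ∸ k))) (suc n) ≡ a i * (b *ₛ c) (n ∸ i)
  inner i i≤n = begin
    ∑ (λ k → [ i ≤ k ] (a i * b (k ∸ i) * c (n ∸ k))) (suc n)
      ≡⟨ ∑-cong (suc n) (λ k → trans (cong ([ i ≤ k ]_) (ℚₚ.*-assoc (a i) (b (k ∸ i)) (c (n ∸ k))))
                                     (sym ([≤]-*ˡ i k (a i) (b (k ∸ i) * c (n ∸ k))))) ⟩
    ∑ (λ k → a i * [ i ≤ k ] (b (k ∸ i) * c (n ∸ k))) (suc n)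
      ≡⟨ sym (∑-*ˡ (a i) (λ k → [ i ≤ k ] (b (k ∸ i) * c (n ∸ k))) (suc n)) ⟩
    a i * ∑ (λ k → [ i ≤ k ] (b (k ∸ i) * c (n ∸ k))) (suc n)
      ≡⟨ cong (a i *_) (subst (λ N → ∑ (λ k → [ i ≤ k ] (b (k ∸ i) * c (n ∸ k))) N
                                      ≡ ∑ (λ j → b (i ℕ.+ j ∸ i) * c (n ∸ (i ℕ.+ j))) (suc n ∸ i))
                               (ℕₚ.m+[n∸m]≡n (ℕₚ.m≤n⇒m≤1+n i≤n))
                               (∑-[≤]-above (λ k → b (k ∸ i) * c (n ∸ k)) i (suc n ∸ i))) ⟩
    a i * ∑ (λ j → b (i ℕ.+ j ∸ i) * c (n ∸ (i ℕ.+ j))) (suc n ∸ i)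
      ≡⟨ cong (a i *_) (trans (cong (∑ (λ j → b (i ℕ.+ j ∸ i) * c (n ∸ (i ℕ.+ j)))) (ℕₚ.+-∸-assoc 1 i≤n))
                              (∑-cong (suc (n ∸ i)) (λ j → cong₂ (λ u v → b u * c v)
                                  (ℕₚ.m+n∸m≡n i j) (sym (ℕₚ.∸-+-assoc n i j))))) ⟩
    a i * ∑ (λ j → b j * c (n ∸ i ∸ j)) (suc (n ∸ i))
      ≡⟨ cong (a i *_) (sym (*ₛ-coeff b c (n ∸ i))) ⟩
    a i * (b *ₛ c) (n ∸ i)
      ∎

-- Wrapping _≗_ in a record keeps the two series recoverable from an equation,
-- which the ring solver needs to infer its arguments.
infix 4 _≋_
record _≋_ (f g : Series) : Set where
  constructor mk≋
  field coeff≡ : f ≗ g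
open _≋_ public

seriesRing : CommutativeRing _ _
seriesRing = record
  { Carrier = Series
  ; _≈_     = _≋_
  ; _+_     = _+ₛ_
  ; _*_     = _*ₛ_
  ; -_      = -ₛ_
  ; 0#      = 0ₛ
  ; 1#      = 1ₛ
  ; isCommutativeRing = record
    { isRing = record
      { +-isAbelianGroup = record
        { isGroup = record
          { isMonoid = record
            { isSemigroup = record
              { isMagma = record
                { isEquivalence = record
                  { refl  = mk≋ (λ _ → refl)
                  ; sym   = λ p → mk≋ (λ n → sym (coeff≡ p n))
                  ; trans = λ p q → mk≋ (λ n → trans (coeff≡ p n) (coeff≡ q n)) }
                ; ∙-cong = λ p q → mk≋ (λ n → cong₂ _+_ (coeff≡ p n) (coeff≡ q n)) }
              ; assoc = λ f g h → mk≋ (λ n → ℚₚ.+-assoc (f n) (g n) (h n)) }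
            ; identity = (λ f → mk≋ (λ n → ℚₚ.+-identityˡ (f n))) , (λ f → mk≋ (λ n → ℚₚ.+-identityʳ (f n))) }
          ; inverse = (λ f → mk≋ (λ n → ℚₚ.+-inverseˡ (f n))) , (λ f → mk≋ (λ n → ℚₚ.+-inverseʳ (f n)))
          ; ⁻¹-cong = λ p → mk≋ (λ n → cong -_ (coeff≡ p n)) }
        ; comm = λ f g → mk≋ (λ n → ℚₚ.+-comm (f n) (g n)) }
      ; *-cong = λ p q → mk≋ (*ₛ-cong (coeff≡ p) (coeff≡ q))
      ; *-assoc = λ f g h → mk≋ (*ₛ-assoc f g h)
      ; *-identity = (λ f → mk≋ (*ₛ-identityˡ f)) , (λ f → mk≋ (λ n → trans (*ₛ-comm f 1ₛ n) (*ₛ-identityˡ f n)))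
      ; distrib = (λ f g h → mk≋ (*ₛ-distribˡ f g h)) , (λ f g h → mk≋ (*ₛ-distribʳ f g h)) }
    ; *-comm = λ f g → mk≋ (*ₛ-comm f g) }
  }

module Series = CommutativeRing seriesRing

≋-refl : ∀ f → f ≋ f
≋-refl f = Series.refl

constₛ-+ : ∀ a b → constₛ (a + b) ≗ (constₛ a +ₛ constₛ b)
constₛ-+ a b zero    = refl
constₛ-+ a b (suc n) = sym (ℚₚ.+-identityˡ 0ℚ)

constₛ-* : ∀ a b → constₛ (a * b) ≗ (constₛ a *ₛ constₛ b)
constₛ-* a b zero    = sym (ℚₚ.+-identityʳ (a * b))
constₛ-* a b (suc n) = sym (trans (*ₛ-coeff (constₛ a) (constₛ b) (suc n))
  (trans (cong₂ _+_ (ℚₚ.*-zeroʳ a) (∑-zero (suc n) (λ i _ → ℚₚ.*-zeroˡ (constₛ b (n ∸ i))))) (ℚₚ.+-identityˡ 0ℚ)))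

constₛ-neg : ∀ a → constₛ (- a) ≗ (-ₛ constₛ a)
constₛ-neg a zero    = refl
constₛ-neg a (suc n) = refl

constₛ-morphism : ACR._-Raw-AlmostCommutative⟶_ (CommutativeRing.rawRing ℚₚ.+-*-commutativeRing)
                                                  (ACR.fromCommutativeRing seriesRing)
constₛ-morphism = record
  { ⟦_⟧    = constₛ
  ; +-homo = λ a b → mk≋ (constₛ-+ a b)
  ; *-homo = λ a b → mk≋ (constₛ-* a b)
  ; -‿homo = λ a → mk≋ (constₛ-neg a)
  ; 0-homo = mk≋ (λ { zero → refl ; (suc n) → refl })
  ; 1-homo = mk≋ (λ { zero → refl ; (suc n) → refl }) }

constₛ-≟ : ∀ a b → Maybe (constₛ a ≋ constₛ b)
constₛ-≟ a b with a ℚₚ.≟ b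
... | yes refl = just Series.refl
... | no  _    = nothing

module SeriesSolver = RingSolver (CommutativeRing.rawRing ℚₚ.+-*-commutativeRing)
                                 (ACR.fromCommutativeRing seriesRing) constₛ-morphism constₛ-≟

at-++-< : ∀ (xs : List ℚ) y i → i < length xs → at (xs ++ y ∷ []) i ≡ at xs i
at-++-< (x ∷ xs) y zero    _         = refl
at-++-< (x ∷ xs) y (suc i) (s≤s i<n) = at-++-< xs y i i<n

at-++-length : ∀ (xs : List ℚ) y n → length xs ≡ n → at (xs ++ y ∷ []) n ≡ y
at-++-length []       y zero    _  = refl
at-++-length (x ∷ xs) y (suc n) eq = at-++-length xs y n (ℕₚ.suc-injective eq)

length-snoc : ∀ (xs : List ℚ) y → length (xs ++ y ∷ []) ≡ suc (length xs)
length-snoc xs y = trans (length-++ xs) (ℕₚ.+-comm (length xs) 1)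

length-sqrtList : ∀ f n → length (sqrtList f n) ≡ suc n
length-sqrtList f zero    = refl
length-sqrtList f (suc n) = trans (length-snoc (sqrtList f n) _) (cong suc (length-sqrtList f n))

length-invList : ∀ f n → length (invList f n) ≡ suc n
length-invList f zero    = refl
length-invList f (suc n) = trans (length-snoc (invList f n) _) (cong suc (length-invList f n))

at-snoc-stable : (L : ℕ → List ℚ) → (∀ n → length (L n) ≡ suc n) →
                 (∀ n → Σ[ y ∈ ℚ ] L (suc n) ≡ L n ++ y ∷ []) →
                 ∀ n i → i ≤ n → at (L n) i ≡ at (L i) i
at-snoc-stable L len step zero    zero    z≤n = refl
at-snoc-stable L len step (suc n) i i≤1+n with ℕₚ.m≤n⇒m<n∨m≡n i≤1+n
... | inj₂ refl       = refl
... | inj₁ (s≤s i≤n) with step n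
...   | y , eq = trans (cong (λ l → at l i) eq)
                       (trans (at-++-< (L n) y i (subst (i <_) (sym (len n)) (s≤s i≤n)))
                              (at-snoc-stable L len step n i i≤n))

sqrtList-stable : ∀ f n i → i ≤ n → at (sqrtList f n) i ≡ sqrtₛ f i
sqrtList-stable f = at-snoc-stable (sqrtList f) (length-sqrtList f) (λ n → _ , refl)

invList-stable : ∀ f n i → i ≤ n → at (invList f n) i ≡ invₛ f i
invList-stable f = at-snoc-stable (invList f) (length-invList f) (λ n → _ , refl)

innerSquare : Series → ℕ → ℚ
innerSquare t n = ∑ (λ i → t (suc i) * t (n ∸ i)) n

*ₛ-square-suc : ∀ t n → (t *ₛ t) (suc n) ≡ t 0 * t (suc n) + (innerSquare t n + t (suc n) * t 0)
*ₛ-square-suc t n = begin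
  (t *ₛ t) (suc n)                                                   ≡⟨ *ₛ-coeff t t (suc n) ⟩
  t 0 * t (suc n) + ∑ (λ i → t (suc i) * t (n ∸ i)) (suc n)          ≡⟨ cong (_+_ (t 0 * t (suc n))) (∑-last (λ i → t (suc i) * t (n ∸ i)) n) ⟩
  t 0 * t (suc n) + (innerSquare t n + t (suc n) * t (n ∸ n))        ≡⟨ cong (λ k → t 0 * t (suc n) + (innerSquare t n + t (suc n) * t k)) (ℕₚ.n∸n≡0 n) ⟩
  t 0 * t (suc n) + (innerSquare t n + t (suc n) * t 0)              ∎
  where open ≡-Reasoning

sqrtₛ-suc : ∀ f n → sqrtₛ f (suc n) ≡ (f (suc n) - innerSquare (sqrtₛ f) n) * ½
sqrtₛ-suc f n = begin
  sqrtₛ f (suc n)                                  ≡⟨ at-++-length (sqrtList f n) _ (suc n) (length-sqrtList f n) ⟩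
  (f (suc n) - Σℚ (upTo (suc n)) inner) * ½        ≡⟨ cong (λ z → (f (suc n) - z) * ½) inner≡ ⟩
  (f (suc n) - innerSquare (sqrtₛ f) n) * ½        ∎
  where
  open ≡-Reasoning
  s = sqrtList f n
  inner : ℕ → ℚ
  inner i = if i ≡ᵇ 0 then 0ℚ else at s i * at s (suc n ∸ i)
  inner≡ : Σℚ (upTo (suc n)) inner ≡ innerSquare (sqrtₛ f) n
  inner≡ = trans (Σℚ-upTo inner (suc n)) (trans (ℚₚ.+-identityˡ _) (∑-cong< n (λ i i<n →
             cong₂ _*_ (sqrtList-stable f n (suc i) i<n) (sqrtList-stable f n (n ∸ i) (ℕₚ.m∸n≤m n i)))))

sqrtₛ-square : ∀ f → f 0 ≡ 1ℚ → (sqrtₛ f *ₛ sqrtₛ f) ≗ f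
sqrtₛ-square f f₀≡1 zero    = sym f₀≡1
sqrtₛ-square f f₀≡1 (suc n) = begin
  (s *ₛ s) (suc n)                                        ≡⟨ *ₛ-square-suc s n ⟩
  1ℚ * s (suc n) + (innerSquare s n + s (suc n) * 1ℚ)     ≡⟨ cong (λ z → 1ℚ * z + (innerSquare s n + z * 1ℚ)) (sqrtₛ-suc f n) ⟩
  1ℚ * h + (innerSquare s n + h * 1ℚ)                     ≡⟨ halves (f (suc n)) (innerSquare s n) ⟩
  f (suc n)                                               ∎
  where
  open ≡-Reasoning
  open +-*-Solver
  s = sqrtₛ f
  h = (f (suc n) - innerSquare s n) * ½
  halves : ∀ a b → 1ℚ * ((a - b) * ½) + (b + (a - b) * ½ * 1ℚ) ≡ a
  halves = solve 2 (λ a b → con 1ℚ :* ((a :- b) :* con ½) :+ (b :+ (a :- b) :* con ½ :* con 1ℚ) := a) refl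

sqrtₛ-unique : ∀ f t → t 0 ≡ 1ℚ → (t *ₛ t) ≗ f → t ≗ sqrtₛ f
sqrtₛ-unique f t t₀≡1 t²≗f n = below n n ℕₚ.≤-refl
  where
  open ≡-Reasoning
  open +-*-Solver
  double : ∀ a b → (a + a + b - b) * ½ ≡ a
  double = solve 2 (λ a b → (a :+ a :+ b :- b) :* con ½ := a) refl
  ends : ∀ a b → a + a + b ≡ 1ℚ * a + (b + a * 1ℚ)
  ends = solve 2 (λ a b → a :+ a :+ b := con 1ℚ :* a :+ (b :+ a :* con 1ℚ)) refl
  below : ∀ n i → i ≤ n → t i ≡ sqrtₛ f i
  below zero    zero z≤n = t₀≡1
  below (suc n) i i≤1+n with ℕₚ.m≤n⇒m<n∨m≡n i≤1+n
  ... | inj₁ (s≤s i≤n) = below n i i≤n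
  ... | inj₂ refl      = begin
    t (suc n)                                         ≡⟨ sym (double (t (suc n)) (innerSquare t n)) ⟩
    (t (suc n) + t (suc n) + innerSquare t n - innerSquare t n) * ½
                                                      ≡⟨ cong (λ z → (z - innerSquare t n) * ½) t²≡f ⟩
    (f (suc n) - innerSquare t n) * ½                 ≡⟨ cong (λ z → (f (suc n) - z) * ½) inner≡ ⟩
    (f (suc n) - innerSquare (sqrtₛ f) n) * ½         ≡⟨ sym (sqrtₛ-suc f n) ⟩
    sqrtₛ f (suc n)                                   ∎
    where
    inner≡ : innerSquare t n ≡ innerSquare (sqrtₛ f) n
    inner≡ = ∑-cong< n (λ i i<n → cong₂ _*_ (below n (suc i) i<n) (below n (n ∸ i) (ℕₚ.m∸n≤m n i)))
    t²≡f : t (suc n) + t (suc n) + innerSquare t n ≡ f (suc n)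
    t²≡f = begin
      t (suc n) + t (suc n) + innerSquare t n                       ≡⟨ ends (t (suc n)) (innerSquare t n) ⟩
      1ℚ * t (suc n) + (innerSquare t n + t (suc n) * 1ℚ)           ≡⟨ cong (λ z → z * t (suc n) + (innerSquare t n + t (suc n) * z)) (sym t₀≡1) ⟩
      t 0 * t (suc n) + (innerSquare t n + t (suc n) * t 0)         ≡⟨ sym (*ₛ-square-suc t n) ⟩
      (t *ₛ t) (suc n)                                              ≡⟨ t²≗f (suc n) ⟩
      f (suc n)                                                     ∎

invₛ-suc : ∀ g n → invₛ g (suc n) ≡ - ∑ (λ i → g (suc i) * invₛ g (n ∸ i)) (suc n)
invₛ-suc g n = trans (at-++-length (invList g n) _ (suc n) (length-invList g n))
  (cong -_ (trans (Σℚ-upTo (λ i → g (suc i) * at (invList g n) (n ∸ i)) (suc n))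
                  (∑-cong (suc n) (λ i → cong (g (suc i) *_) (invList-stable g n (n ∸ i) (ℕₚ.m∸n≤m n i))))))

*ₛ-invₛ : ∀ g → g 0 ≡ 1ℚ → (g *ₛ invₛ g) ≗ 1ₛ
*ₛ-invₛ g g₀≡1 zero    = trans (ℚₚ.+-identityʳ _) (trans (cong (_* 1ℚ) g₀≡1) refl)
*ₛ-invₛ g g₀≡1 (suc n) = begin
  (g *ₛ invₛ g) (suc n)             ≡⟨ *ₛ-coeff g (invₛ g) (suc n) ⟩
  g 0 * invₛ g (suc n) + tail       ≡⟨ cong₂ (λ a b → a * b + tail) g₀≡1 (invₛ-suc g n) ⟩
  1ℚ * - tail + tail                 ≡⟨ cancel tail ⟩
  0ℚ                                ∎
  where
  open ≡-Reasoning
  open +-*-Solver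
  tail = ∑ (λ i → g (suc i) * invₛ g (n ∸ i)) (suc n)
  cancel : ∀ a → 1ℚ * - a + a ≡ 0ℚ
  cancel = solve 1 (λ a → con 1ℚ :* (:- a) :+ a := con 0ℚ) refl

ℚof-mkℚ : ∀ z → ℚof z ≡ mkℚ z 0 (Coprime.sym (Coprime.1-coprimeTo ℤ.∣ z ∣))
ℚof-mkℚ z = ℚₚ.↥p/↧p≡p (mkℚ z 0 _)

ℚof-+ : ∀ a b → ℚof (a ℤ.+ b) ≡ ℚof a + ℚof b
ℚof-+ a b rewrite ℚof-mkℚ a | ℚof-mkℚ b = cong (_/ 1) (sym (cong₂ ℤ._+_ (ℤₚ.*-identityʳ a) (ℤₚ.*-identityʳ b)))

ℚof-* : ∀ a b → ℚof (a ℤ.* b) ≡ ℚof a * ℚof b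
ℚof-* a b rewrite ℚof-mkℚ a | ℚof-mkℚ b = refl

ℚof-suc-nonzero : ∀ n q → q * ℚof (+ suc n) ≡ 0ℚ → q ≡ 0ℚ
ℚof-suc-nonzero n q q*r≡0 = begin
  q                    ≡⟨ sym (ℚₚ.*-identityʳ q) ⟩
  q * 1ℚ               ≡⟨ cong (q *_) (sym (ℚₚ.*-inverseʳ r)) ⟩
  q * (r * 1/ r)       ≡⟨ sym (ℚₚ.*-assoc q r (1/ r)) ⟩
  (q * r) * 1/ r       ≡⟨ cong (_* 1/ r) (trans (cong (q *_) (sym (ℚof-mkℚ (+ suc n)))) q*r≡0) ⟩
  0ℚ * 1/ r            ≡⟨ ℚₚ.*-zeroˡ (1/ r) ⟩
  0ℚ                   ∎
  where
  open ≡-Reasoning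
  r = mkℚ (+ suc n) 0 (Coprime.sym (Coprime.1-coprimeTo (suc n)))

ℚofℕ : ℕ → ℚ
ℚofℕ n = ℚof (+ n)

shiftₛ : Series → Series
shiftₛ f zero    = 0ℚ
shiftₛ f (suc n) = f n

Xₛ-*ₛ : ∀ f → (Xₛ *ₛ f) ≗ shiftₛ f
Xₛ-*ₛ f zero    = trans (ℚₚ.+-identityʳ _) (ℚₚ.*-zeroˡ (f 0))
Xₛ-*ₛ f (suc n) = begin
  (Xₛ *ₛ f) (suc n)
    ≡⟨ *ₛ-coeff Xₛ f (suc n) ⟩
  0ℚ * f (suc n) + (1ℚ * f (n ∸ 0) + ∑ (λ i → 0ℚ * f (n ∸ suc i)) n)
    ≡⟨ cong₂ _+_ (ℚₚ.*-zeroˡ (f (suc n)))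
                 (cong₂ _+_ (ℚₚ.*-identityˡ (f n)) (∑-zero n (λ i _ → ℚₚ.*-zeroˡ (f (n ∸ suc i))))) ⟩
  0ℚ + (f n + 0ℚ)
    ≡⟨ trans (ℚₚ.+-identityˡ _) (ℚₚ.+-identityʳ (f n)) ⟩
  f n
    ∎
  where open ≡-Reasoning

∂ : Series → Series
∂ f n = ℚofℕ (suc n) * f (suc n)

∂-*ₛ : ∀ f g → ∂ (f *ₛ g) ≗ ((∂ f *ₛ g) +ₛ (f *ₛ ∂ g))
∂-*ₛ f g n = begin
  ℚofℕ (suc n) * (f *ₛ g) (suc n)                         ≡⟨ cong (ℚofℕ (suc n) *_) (*ₛ-coeff f g (suc n)) ⟩
  ℚofℕ (suc n) * ∑ w (suc (suc n))                        ≡⟨ ∑-*ˡ (ℚofℕ (suc n)) w (suc (suc n)) ⟩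
  ∑ (λ i → ℚofℕ (suc n) * w i) (suc (suc n))              ≡⟨ ∑-cong< (suc (suc n)) (λ i i≤ → split i (ℕₚ.≤-pred i≤)) ⟩
  ∑ (λ i → ℚofℕ i * w i + ℚofℕ (suc n ∸ i) * w i) (suc (suc n))
                                                          ≡⟨ ∑-+ (λ i → ℚofℕ i * w i) (λ i → ℚofℕ (suc n ∸ i) * w i) (suc (suc n)) ⟩
  ∑ (λ i → ℚofℕ i * w i) (suc (suc n)) + ∑ (λ i → ℚofℕ (suc n ∸ i) * w i) (suc (suc n))
                                                          ≡⟨ cong₂ _+_ leftPart rightPart ⟩
  (∂ f *ₛ g) n + (f *ₛ ∂ g) n                             ∎
  where
  open ≡-Reasoning
  w : ℕ → ℚ
  w i = f i * g (suc n ∸ i)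
  -- Leibniz's rule is the identity n+1 = i + (n+1-i) applied to each term of the product.
  split : ∀ i → i ≤ suc n → ℚofℕ (suc n) * w i ≡ ℚofℕ i * w i + ℚofℕ (suc n ∸ i) * w i
  split i i≤ = trans (cong (λ k → ℚofℕ k * w i) (sym (ℕₚ.m+[n∸m]≡n i≤)))
                     (trans (cong (_* w i) (ℚof-+ (+ i) (+ (suc n ∸ i)))) (ℚₚ.*-distribʳ-+ (w i) (ℚofℕ i) _))
  leftPart : ∑ (λ i → ℚofℕ i * w i) (suc (suc n)) ≡ (∂ f *ₛ g) n
  leftPart = begin
    ℚofℕ 0 * w 0 + rest                         ≡⟨ cong (_+ rest) (ℚₚ.*-zeroˡ (w 0)) ⟩
    0ℚ + rest                                   ≡⟨ ℚₚ.+-identityˡ rest ⟩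
    ∑ (λ i → ℚofℕ (suc i) * w (suc i)) (suc n)  ≡⟨ ∑-cong (suc n) (λ i → sym (ℚₚ.*-assoc (ℚofℕ (suc i)) (f (suc i)) (g (n ∸ i)))) ⟩
    ∑ (λ i → ∂ f i * g (n ∸ i)) (suc n)         ≡⟨ sym (*ₛ-coeff (∂ f) g n) ⟩
    (∂ f *ₛ g) n                                ∎
    where rest = ∑ (λ i → ℚofℕ (suc i) * w (suc i)) (suc n)
  rightPart : ∑ (λ i → ℚofℕ (suc n ∸ i) * w i) (suc (suc n)) ≡ (f *ₛ ∂ g) n
  rightPart = begin
    ∑ (λ i → ℚofℕ (suc n ∸ i) * w i) (suc (suc n))
      ≡⟨ ∑-last (λ i → ℚofℕ (suc n ∸ i) * w i) (suc n) ⟩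
    ∑ (λ i → ℚofℕ (suc n ∸ i) * w i) (suc n) + ℚofℕ (n ∸ n) * w (suc n)
      ≡⟨ trans (cong (λ k → rest + ℚofℕ k * w (suc n)) (ℕₚ.n∸n≡0 n))
               (trans (cong (_+_ rest) (ℚₚ.*-zeroˡ (w (suc n)))) (ℚₚ.+-identityʳ rest)) ⟩
    ∑ (λ i → ℚofℕ (suc n ∸ i) * w i) (suc n)
      ≡⟨ ∑-cong< (suc n) (λ i i≤n → trans (cong (λ k → ℚofℕ k * (f i * g k)) (ℕₚ.+-∸-assoc 1 (ℕₚ.≤-pred i≤n)))
                                           (swap (ℚofℕ (suc (n ∸ i))) (f i) (g (suc (n ∸ i))))) ⟩
    ∑ (λ i → f i * ∂ g (n ∸ i)) (suc n)
      ≡⟨ sym (*ₛ-coeff f (∂ g) n) ⟩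
    (f *ₛ ∂ g) n
      ∎
    where
    rest = ∑ (λ i → ℚofℕ (suc n ∸ i) * w i) (suc n)
    swap : ∀ a b c → a * (b * c) ≡ b * (a * c)
    swap a b c = trans (sym (ℚₚ.*-assoc a b c)) (trans (cong (_* c) (ℚₚ.*-comm a b)) (ℚₚ.*-assoc b a c))

∂≗0⇒constant : ∀ f → ∂ f ≗ 0ₛ → f ≗ constₛ (f 0)
∂≗0⇒constant f ∂f≗0 zero    = refl
∂≗0⇒constant f ∂f≗0 (suc n) = ℚof-suc-nonzero n (f (suc n)) (trans (ℚₚ.*-comm (f (suc n)) _) (∂f≗0 n))

*ₛ-unit≗0⇒≗0 : ∀ f g k → g 0 * k ≡ 1ℚ → (f *ₛ g) ≗ 0ₛ → f ≗ 0ₛ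
*ₛ-unit≗0⇒≗0 f g k g₀k≡1 fg≗0 n = below n n ℕₚ.≤-refl
  where
  open ≡-Reasoning
  next : ∀ m → (∀ j → j < m → f j ≡ 0ℚ) → f m ≡ 0ℚ
  next m f<m≡0 = begin
    f m                  ≡⟨ sym (ℚₚ.*-identityʳ (f m)) ⟩
    f m * 1ℚ             ≡⟨ cong (f m *_) (sym g₀k≡1) ⟩
    f m * (g 0 * k)      ≡⟨ sym (ℚₚ.*-assoc (f m) (g 0) k) ⟩
    (f m * g 0) * k      ≡⟨ cong (_* k) fm·g₀≡0 ⟩
    0ℚ * k               ≡⟨ ℚₚ.*-zeroˡ k ⟩
    0ℚ                   ∎
    where
    fm·g₀≡0 : f m * g 0 ≡ 0ℚ
    fm·g₀≡0 = begin
      f m * g 0                                            ≡⟨ sym (ℚₚ.+-identityˡ _) ⟩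
      0ℚ + f m * g 0                                       ≡⟨ cong₂ _+_ (sym (∑-zero m (λ j j<m → trans (cong (_* g (m ∸ j)) (f<m≡0 j j<m))
                                                                                                     (ℚₚ.*-zeroˡ (g (m ∸ j))))))
                                                                     (cong (λ i → f m * g i) (sym (ℕₚ.n∸n≡0 m))) ⟩
      ∑ (λ j → f j * g (m ∸ j)) m + f m * g (m ∸ m)        ≡⟨ sym (∑-last (λ j → f j * g (m ∸ j)) m) ⟩
      ∑ (λ j → f j * g (m ∸ j)) (suc m)                    ≡⟨ sym (*ₛ-coeff f g m) ⟩
      (f *ₛ g) m                                           ≡⟨ fg≗0 m ⟩
      0ℚ                                                   ∎
  below : ∀ n i → i ≤ n → f i ≡ 0ℚ
  below zero    zero z≤n = next 0 (λ j ())
  below (suc n) i i≤1+n with ℕₚ.m≤n⇒m<n∨m≡n i≤1+n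
  ... | inj₁ (s≤s i≤n) = below n i i≤n
  ... | inj₂ refl      = next (suc n) (λ j j≤n → below n j (ℕₚ.≤-pred j≤n))

evenₛ oddₛ : Series → Series
evenₛ f n = f (n ℕ.+ n)
oddₛ  f n = f (suc (n ℕ.+ n))

private
  double-suc : ∀ m → suc m ℕ.+ suc m ≡ suc (suc (m ℕ.+ m))
  double-suc m = cong suc (ℕₚ.+-suc m m)

  double-∸ : ∀ j n → j ≤ n → (n ℕ.+ n) ∸ (j ℕ.+ j) ≡ (n ∸ j) ℕ.+ (n ∸ j)
  double-∸ zero    n       z≤n       = refl
  double-∸ (suc j) (suc n) (s≤s j≤n) = trans (cong₂ _∸_ (double-suc n) (double-suc j)) (double-∸ j n j≤n)

  double-mono : ∀ {j n} → j ≤ n → j ℕ.+ j ≤ n ℕ.+ n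
  double-mono j≤n = ℕₚ.+-mono-≤ j≤n j≤n

∑-parity : ∀ (h : ℕ → ℚ) m → ∑ h (m ℕ.+ m) ≡ ∑ (λ j → h (j ℕ.+ j)) m + ∑ (λ j → h (suc (j ℕ.+ j))) m
∑-parity h zero    = sym (ℚₚ.+-identityˡ 0ℚ)
∑-parity h (suc m) = begin
  ∑ h (suc m ℕ.+ suc m)                         ≡⟨ cong (∑ h) (double-suc m) ⟩
  h 0 + (h 1 + ∑ (h ∘ suc ∘ suc) (m ℕ.+ m))     ≡⟨ cong (λ z → h 0 + (h 1 + z)) (∑-parity (h ∘ suc ∘ suc) m) ⟩
  h 0 + (h 1 + (evens + odds))                  ≡⟨ regroup (h 0) (h 1) evens odds ⟩
  (h 0 + evens) + (h 1 + odds)                  ≡⟨ cong₂ (λ u v → (h 0 + u) + (h 1 + v))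
                                                         (∑-cong m (λ j → cong h (sym (double-suc j))))
                                                         (∑-cong m (λ j → cong (h ∘ suc) (sym (double-suc j)))) ⟩
  ∑ (λ j → h (j ℕ.+ j)) (suc m) + ∑ (λ j → h (suc (j ℕ.+ j))) (suc m) ∎
  where
  open ≡-Reasoning
  open +-*-Solver
  evens = ∑ (λ j → h (suc (suc (j ℕ.+ j)))) m
  odds  = ∑ (λ j → h (suc (suc (suc (j ℕ.+ j))))) m
  regroup : ∀ a b c d → a + (b + (c + d)) ≡ (a + c) + (b + d)
  regroup = solve 4 (λ a b c d → a :+ (b :+ (c :+ d)) := (a :+ c) :+ (b :+ d)) refl

evenₛ-*ₛ : ∀ f g → evenₛ (f *ₛ g) ≗ ((evenₛ f *ₛ evenₛ g) +ₛ shiftₛ (oddₛ f *ₛ oddₛ g))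
evenₛ-*ₛ f g n = begin
  (f *ₛ g) (n ℕ.+ n)                                   ≡⟨ *ₛ-coeff f g (n ℕ.+ n) ⟩
  ∑ h (suc (n ℕ.+ n))                                  ≡⟨ ∑-last h (n ℕ.+ n) ⟩
  ∑ h (n ℕ.+ n) + h (n ℕ.+ n)                          ≡⟨ cong (_+ h (n ℕ.+ n)) (∑-parity h n) ⟩
  (evens + odds) + h (n ℕ.+ n)                         ≡⟨ regroup evens odds (h (n ℕ.+ n)) ⟩
  (evens + h (n ℕ.+ n)) + odds                         ≡⟨ cong₂ _+_ evenPart (oddPart n) ⟩
  (evenₛ f *ₛ evenₛ g) n + shiftₛ (oddₛ f *ₛ oddₛ g) n ∎
  where
  open ≡-Reasoning
  open +-*-Solver
  h : ℕ → ℚ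
  h i = f i * g ((n ℕ.+ n) ∸ i)
  evens = ∑ (λ j → h (j ℕ.+ j)) n
  odds  = ∑ (λ j → h (suc (j ℕ.+ j))) n
  regroup : ∀ a b c → (a + b) + c ≡ (a + c) + b
  regroup = solve 3 (λ a b c → (a :+ b) :+ c := (a :+ c) :+ b) refl
  evenPart : evens + h (n ℕ.+ n) ≡ (evenₛ f *ₛ evenₛ g) n
  evenPart = begin
    evens + h (n ℕ.+ n)                                               ≡⟨ cong₂ _+_
         (∑-cong< n (λ j j<n → cong (λ k → f (j ℕ.+ j) * g k) (double-∸ j n (ℕₚ.<⇒≤ j<n))))
         (cong (λ k → f (n ℕ.+ n) * g k) (trans (ℕₚ.n∸n≡0 (n ℕ.+ n)) (sym (cong (λ z → z ℕ.+ z) (ℕₚ.n∸n≡0 n))))) ⟩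
    ∑ (λ j → evenₛ f j * evenₛ g (n ∸ j)) n + evenₛ f n * evenₛ g (n ∸ n) ≡⟨ sym (∑-last (λ j → evenₛ f j * evenₛ g (n ∸ j)) n) ⟩
    ∑ (λ j → evenₛ f j * evenₛ g (n ∸ j)) (suc n)                     ≡⟨ sym (*ₛ-coeff (evenₛ f) (evenₛ g) n) ⟩
    (evenₛ f *ₛ evenₛ g) n                                            ∎
  oddPart : ∀ n → ∑ (λ j → f (suc (j ℕ.+ j)) * g ((n ℕ.+ n) ∸ suc (j ℕ.+ j))) n ≡ shiftₛ (oddₛ f *ₛ oddₛ g) n
  oddPart zero    = refl
  oddPart (suc m) = trans (∑-cong< (suc m) (λ j j≤m → cong (λ k → f (suc (j ℕ.+ j)) * g k)
                            (trans (cong (_∸ suc (j ℕ.+ j)) (double-suc m))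
                            (trans (ℕₚ.+-∸-assoc 1 (double-mono (ℕₚ.≤-pred j≤m)))
                                   (cong suc (double-∸ j m (ℕₚ.≤-pred j≤m)))))))
                          (sym (*ₛ-coeff (oddₛ f) (oddₛ g) m))

oddₛ-*ₛ : ∀ f g → oddₛ (f *ₛ g) ≗ ((evenₛ f *ₛ oddₛ g) +ₛ (oddₛ f *ₛ evenₛ g))
oddₛ-*ₛ f g n = begin
  (f *ₛ g) (suc (n ℕ.+ n))                             ≡⟨ *ₛ-coeff f g (suc (n ℕ.+ n)) ⟩
  ∑ h (suc (suc (n ℕ.+ n)))                            ≡⟨ cong (∑ h) (sym (double-suc n)) ⟩
  ∑ h (suc n ℕ.+ suc n)                                ≡⟨ ∑-parity h (suc n) ⟩
  ∑ (λ j → h (j ℕ.+ j)) (suc n) + ∑ (λ j → h (suc (j ℕ.+ j))) (suc n)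
                                                       ≡⟨ cong₂ _+_ evenPart oddPart ⟩
  (evenₛ f *ₛ oddₛ g) n + (oddₛ f *ₛ evenₛ g) n        ∎
  where
  open ≡-Reasoning
  h : ℕ → ℚ
  h i = f i * g (suc (n ℕ.+ n) ∸ i)
  evenPart : ∑ (λ j → h (j ℕ.+ j)) (suc n) ≡ (evenₛ f *ₛ oddₛ g) n
  evenPart = trans (∑-cong< (suc n) (λ j j≤n → cong (λ k → f (j ℕ.+ j) * g k)
                     (trans (ℕₚ.+-∸-assoc 1 (double-mono (ℕₚ.≤-pred j≤n))) (cong suc (double-∸ j n (ℕₚ.≤-pred j≤n))))))
                   (sym (*ₛ-coeff (evenₛ f) (oddₛ g) n))
  oddPart : ∑ (λ j → h (suc (j ℕ.+ j))) (suc n) ≡ (oddₛ f *ₛ evenₛ g) n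
  oddPart = trans (∑-cong< (suc n) (λ j j≤n → cong (λ k → f (suc (j ℕ.+ j)) * g k) (double-∸ j n (ℕₚ.≤-pred j≤n))))
                  (sym (*ₛ-coeff (oddₛ f) (evenₛ g) n))

-- Trinomial coefficients

-- trinomial k m = [yᵐ] (y⁻¹ + 1 + y)ᵏ

trinomial : ℕ → ℤ → ℕ
trinomial zero    m = if ⌊ m ℤ.≟ + 0 ⌋ then 1 else 0
trinomial (suc k) m = trinomial k (ℤ.pred m) ℕ.+ trinomial k m ℕ.+ trinomial k (ℤ.suc m)

trinomial-neg : ∀ k m → trinomial k (ℤ.- m) ≡ trinomial k m
trinomial-neg zero    (+ zero)  = refl
trinomial-neg zero    (+ suc n) = refl
trinomial-neg zero    -[1+ n ]  = refl
trinomial-neg (suc k) m = begin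
  W (ℤ.pred (ℤ.- m)) ℕ.+ W (ℤ.- m) ℕ.+ W (ℤ.suc (ℤ.- m))   ≡⟨ cong₂ (λ u v → W u ℕ.+ W (ℤ.- m) ℕ.+ W v)
                                                                   (sym (ℤₚ.neg-distrib-+ (+ 1) m)) (sym (ℤₚ.neg-distrib-+ ℤ.-1ℤ m)) ⟩
  W (ℤ.- ℤ.suc m) ℕ.+ W (ℤ.- m) ℕ.+ W (ℤ.- ℤ.pred m)       ≡⟨ cong₂ ℕ._+_ (cong₂ ℕ._+_ (trinomial-neg k (ℤ.suc m)) (trinomial-neg k m))
                                                                   (trinomial-neg k (ℤ.pred m)) ⟩
  W (ℤ.suc m) ℕ.+ W m ℕ.+ W (ℤ.pred m)                     ≡⟨ reverse (W (ℤ.suc m)) (W m) (W (ℤ.pred m)) ⟩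
  W (ℤ.pred m) ℕ.+ W m ℕ.+ W (ℤ.suc m)                     ∎
  where
  open ≡-Reasoning
  open ℕ-Solver.+-*-Solver
  W = trinomial k
  reverse : ∀ a b c → a ℕ.+ b ℕ.+ c ≡ c ℕ.+ b ℕ.+ a
  reverse = solve 3 (λ a b c → a :+ b :+ c := c :+ b :+ a) refl

trinomialℤ : ℕ → ℤ → ℤ
trinomialℤ k m = + trinomial k m

-- Apply y ∂/∂y to (y⁻¹ + 1 + y)^(k+1) = (y⁻¹ + 1 + y) (y⁻¹ + 1 + y)ᵏ.
trinomial-yDerivative : ∀ k m → m ℤ.* trinomialℤ (suc k) m
                               ≡ + suc k ℤ.* (trinomialℤ k (ℤ.pred m) ℤ.- trinomialℤ k (ℤ.suc m))
trinomial-yDerivative zero m =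
  base m (W (ℤ.pred m)) (W m) (W (ℤ.suc m)) (off (ℤ.pred m)) (off m) (off (ℤ.suc m))
  where
  open ≡-Reasoning
  open ℤ-Solver.+-*-Solver
  W = trinomialℤ 0
  off : ∀ x → x ℤ.* W x ≡ + 0
  off x with x ℤ.≟ + 0
  ... | yes refl = refl
  ... | no  _    = ℤₚ.*-zeroʳ x
  base : ∀ m a b c → ℤ.pred m ℤ.* a ≡ + 0 → m ℤ.* b ≡ + 0 → ℤ.suc m ℤ.* c ≡ + 0 →
         m ℤ.* (a ℤ.+ b ℤ.+ c) ≡ + 1 ℤ.* (a ℤ.- c)
  base m a b c ha hb hc = begin
    m ℤ.* (a ℤ.+ b ℤ.+ c)
      ≡⟨ expand m a b c ⟩
    (ℤ.pred m ℤ.* a ℤ.+ a) ℤ.+ m ℤ.* b ℤ.+ (ℤ.suc m ℤ.* c ℤ.- c)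
      ≡⟨ cong₂ (λ u v → (u ℤ.+ a) ℤ.+ v ℤ.+ (ℤ.suc m ℤ.* c ℤ.- c)) ha hb ⟩
    (+ 0 ℤ.+ a) ℤ.+ + 0 ℤ.+ (ℤ.suc m ℤ.* c ℤ.- c)
      ≡⟨ cong (λ w → (+ 0 ℤ.+ a) ℤ.+ + 0 ℤ.+ (w ℤ.- c)) hc ⟩
    (+ 0 ℤ.+ a) ℤ.+ + 0 ℤ.+ (+ 0 ℤ.- c)
      ≡⟨ collect a c ⟩
    + 1 ℤ.* (a ℤ.- c)
      ∎
    where
    expand : ∀ m a b c → m ℤ.* (a ℤ.+ b ℤ.+ c) ≡ (ℤ.pred m ℤ.* a ℤ.+ a) ℤ.+ m ℤ.* b ℤ.+ (ℤ.suc m ℤ.* c ℤ.- c)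
    expand = solve 4 (λ m a b c → m :* (a :+ b :+ c) := ((con ℤ.-1ℤ :+ m) :* a :+ a) :+ m :* b :+ ((con ℤ.1ℤ :+ m) :* c :- c)) refl
    collect : ∀ a c → (+ 0 ℤ.+ a) ℤ.+ + 0 ℤ.+ (+ 0 ℤ.- c) ≡ + 1 ℤ.* (a ℤ.- c)
    collect = solve 2 (λ a c → (con (+ 0) :+ a) :+ con (+ 0) :+ (con (+ 0) :- c) := con (+ 1) :* (a :- c)) refl
trinomial-yDerivative (suc k) m = begin
  m ℤ.* (x₁ ℤ.+ x₂ ℤ.+ x₃)
    ≡⟨ expand m x₁ x₂ x₃ ⟩
  (ℤ.pred m ℤ.* x₁ ℤ.+ m ℤ.* x₂ ℤ.+ ℤ.suc m ℤ.* x₃) ℤ.+ (x₁ ℤ.- x₃)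
    ≡⟨ cong (ℤ._+ (x₁ ℤ.- x₃)) (cong₂ ℤ._+_ (cong₂ ℤ._+_ ih₁ ih₂) ih₃) ⟩
  (K ℤ.* (y₀ ℤ.- y₂) ℤ.+ K ℤ.* (y₁ ℤ.- y₃) ℤ.+ K ℤ.* (y₂ ℤ.- y₄)) ℤ.+ (x₁ ℤ.- x₃)
    ≡⟨ telescope K y₀ y₁ y₂ y₃ y₄ (x₁ ℤ.- x₃) ⟩
  K ℤ.* ((y₀ ℤ.+ y₁ ℤ.+ y₂) ℤ.- (y₂ ℤ.+ y₃ ℤ.+ y₄)) ℤ.+ (x₁ ℤ.- x₃)
    ≡⟨ cong (λ u → K ℤ.* u ℤ.+ (x₁ ℤ.- x₃)) (sym (cong₂ ℤ._-_ x₁≡ x₃≡)) ⟩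
  K ℤ.* (x₁ ℤ.- x₃) ℤ.+ (x₁ ℤ.- x₃)
    ≡⟨ collect K (x₁ ℤ.- x₃) ⟩
  + suc (suc k) ℤ.* (x₁ ℤ.- x₃)
    ∎
  where
  open ≡-Reasoning
  open ℤ-Solver.+-*-Solver
  K = + suc k
  x₁ = trinomialℤ (suc k) (ℤ.pred m)
  x₂ = trinomialℤ (suc k) m
  x₃ = trinomialℤ (suc k) (ℤ.suc m)
  y₀ = trinomialℤ k (ℤ.pred (ℤ.pred m))
  y₁ = trinomialℤ k (ℤ.pred m)
  y₂ = trinomialℤ k m
  y₃ = trinomialℤ k (ℤ.suc m)
  y₄ = trinomialℤ k (ℤ.suc (ℤ.suc m))
  ih₁ : ℤ.pred m ℤ.* x₁ ≡ K ℤ.* (y₀ ℤ.- y₂)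
  ih₁ = trans (trinomial-yDerivative k (ℤ.pred m)) (cong (λ z → K ℤ.* (y₀ ℤ.- trinomialℤ k z)) (ℤₚ.suc-pred m))
  ih₂ : m ℤ.* x₂ ≡ K ℤ.* (y₁ ℤ.- y₃)
  ih₂ = trinomial-yDerivative k m
  ih₃ : ℤ.suc m ℤ.* x₃ ≡ K ℤ.* (y₂ ℤ.- y₄)
  ih₃ = trans (trinomial-yDerivative k (ℤ.suc m)) (cong (λ z → K ℤ.* (trinomialℤ k z ℤ.- y₄)) (ℤₚ.pred-suc m))
  x₁≡ : x₁ ≡ y₀ ℤ.+ y₁ ℤ.+ y₂
  x₁≡ = cong (λ z → y₀ ℤ.+ y₁ ℤ.+ trinomialℤ k z) (ℤₚ.suc-pred m)
  x₃≡ : x₃ ≡ y₂ ℤ.+ y₃ ℤ.+ y₄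
  x₃≡ = cong (λ z → trinomialℤ k z ℤ.+ y₃ ℤ.+ y₄) (ℤₚ.pred-suc m)
  expand : ∀ m x₁ x₂ x₃ → m ℤ.* (x₁ ℤ.+ x₂ ℤ.+ x₃) ≡ (ℤ.pred m ℤ.* x₁ ℤ.+ m ℤ.* x₂ ℤ.+ ℤ.suc m ℤ.* x₃) ℤ.+ (x₁ ℤ.- x₃)
  expand m x₁ x₂ x₃ = solve 4 (λ m x₁ x₂ x₃ → m :* (x₁ :+ x₂ :+ x₃)
                                 := ((con ℤ.-1ℤ :+ m) :* x₁ :+ m :* x₂ :+ (con ℤ.1ℤ :+ m) :* x₃) :+ (x₁ :- x₃)) refl m x₁ x₂ x₃
  telescope : ∀ K y₀ y₁ y₂ y₃ y₄ d → (K ℤ.* (y₀ ℤ.- y₂) ℤ.+ K ℤ.* (y₁ ℤ.- y₃) ℤ.+ K ℤ.* (y₂ ℤ.- y₄)) ℤ.+ d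
                                   ≡ K ℤ.* ((y₀ ℤ.+ y₁ ℤ.+ y₂) ℤ.- (y₂ ℤ.+ y₃ ℤ.+ y₄)) ℤ.+ d
  telescope = solve 7 (λ K y₀ y₁ y₂ y₃ y₄ d → (K :* (y₀ :- y₂) :+ K :* (y₁ :- y₃) :+ K :* (y₂ :- y₄)) :+ d
                                            := K :* ((y₀ :+ y₁ :+ y₂) :- (y₂ :+ y₃ :+ y₄)) :+ d) refl
  collect : ∀ K d → K ℤ.* d ℤ.+ d ≡ (+ 1 ℤ.+ K) ℤ.* d
  collect = solve 2 (λ K d → K :* d :+ d := (con (+ 1) :+ K) :* d) refl

centralTrinomial : ℕ → ℤ
centralTrinomial k = trinomialℤ k (+ 0)

centralTrinomial-suc : ∀ k → centralTrinomial (suc k)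
                           ≡ trinomialℤ k (+ 1) ℤ.+ centralTrinomial k ℤ.+ trinomialℤ k (+ 1)
centralTrinomial-suc k = cong (λ z → + (z ℕ.+ trinomial k (+ 0) ℕ.+ trinomial k (+ 1))) (trinomial-neg k (+ 1))

-- (k + 2) Tₖ₊₂ = (2k + 3) Tₖ₊₁ + 3 (k + 1) Tₖ, written with K = k + 1
centralTrinomial-recurrence : ∀ k → let K = + suc k in
  (+ 1 ℤ.+ K) ℤ.* centralTrinomial (suc (suc k))
    ≡ (+ 1 ℤ.+ (K ℤ.+ K)) ℤ.* centralTrinomial (suc k) ℤ.+ (K ℤ.+ K ℤ.+ K) ℤ.* centralTrinomial k
centralTrinomial-recurrence k =
  combine (+ suc k) t₀ t₁ t₂ u₀ u₁ (trinomialℤ k (+ 2))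
          (centralTrinomial-suc k) (centralTrinomial-suc (suc k)) (trinomial-yDerivative k (+ 1)) refl
  where
  open ≡-Reasoning
  open ℤ-Solver.+-*-Solver
  t₀ = centralTrinomial k
  t₁ = centralTrinomial (suc k)
  t₂ = centralTrinomial (suc (suc k))
  u₀ = trinomialℤ k (+ 1)
  u₁ = trinomialℤ (suc k) (+ 1)
  combine : ∀ K t₀ t₁ t₂ u₀ u₁ w → t₁ ≡ u₀ ℤ.+ t₀ ℤ.+ u₀ → t₂ ≡ u₁ ℤ.+ t₁ ℤ.+ u₁ →
            + 1 ℤ.* u₁ ≡ K ℤ.* (t₀ ℤ.- w) → u₁ ≡ t₀ ℤ.+ u₀ ℤ.+ w →
            (+ 1 ℤ.+ K) ℤ.* t₂ ≡ (+ 1 ℤ.+ (K ℤ.+ K)) ℤ.* t₁ ℤ.+ (K ℤ.+ K ℤ.+ K) ℤ.* t₀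
  combine K t₀ t₁ t₂ u₀ u₁ w refl refl eu₁ refl = begin
    (+ 1 ℤ.+ K) ℤ.* (u₁ ℤ.+ (u₀ ℤ.+ t₀ ℤ.+ u₀) ℤ.+ u₁)
      ≡⟨ expand K t₀ u₀ u₁ ⟩
    + 2 ℤ.* (+ 1 ℤ.* u₁ ℤ.+ K ℤ.* u₁) ℤ.+ (+ 1 ℤ.+ K) ℤ.* (u₀ ℤ.+ t₀ ℤ.+ u₀)
      ≡⟨ cong (λ p → + 2 ℤ.* (p ℤ.+ K ℤ.* u₁) ℤ.+ (+ 1 ℤ.+ K) ℤ.* (u₀ ℤ.+ t₀ ℤ.+ u₀)) eu₁ ⟩
    + 2 ℤ.* (K ℤ.* (t₀ ℤ.- w) ℤ.+ K ℤ.* u₁) ℤ.+ (+ 1 ℤ.+ K) ℤ.* (u₀ ℤ.+ t₀ ℤ.+ u₀)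
      ≡⟨ simplify K t₀ u₀ w ⟩
    (+ 1 ℤ.+ (K ℤ.+ K)) ℤ.* (u₀ ℤ.+ t₀ ℤ.+ u₀) ℤ.+ (K ℤ.+ K ℤ.+ K) ℤ.* t₀
      ∎
    where
    expand : ∀ K t₀ u₀ u₁ → (+ 1 ℤ.+ K) ℤ.* (u₁ ℤ.+ (u₀ ℤ.+ t₀ ℤ.+ u₀) ℤ.+ u₁)
                           ≡ + 2 ℤ.* (+ 1 ℤ.* u₁ ℤ.+ K ℤ.* u₁) ℤ.+ (+ 1 ℤ.+ K) ℤ.* (u₀ ℤ.+ t₀ ℤ.+ u₀)
    expand = solve 4 (λ K t₀ u₀ u₁ → (con (+ 1) :+ K) :* (u₁ :+ (u₀ :+ t₀ :+ u₀) :+ u₁)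
                          := con (+ 2) :* (con (+ 1) :* u₁ :+ K :* u₁) :+ (con (+ 1) :+ K) :* (u₀ :+ t₀ :+ u₀)) refl
    simplify : ∀ K t₀ u₀ w → + 2 ℤ.* (K ℤ.* (t₀ ℤ.- w) ℤ.+ K ℤ.* (t₀ ℤ.+ u₀ ℤ.+ w)) ℤ.+ (+ 1 ℤ.+ K) ℤ.* (u₀ ℤ.+ t₀ ℤ.+ u₀)
                            ≡ (+ 1 ℤ.+ (K ℤ.+ K)) ℤ.* (u₀ ℤ.+ t₀ ℤ.+ u₀) ℤ.+ (K ℤ.+ K ℤ.+ K) ℤ.* t₀
    simplify = solve 4 (λ K t₀ u₀ w → con (+ 2) :* (K :* (t₀ :- w) :+ K :* (t₀ :+ u₀ :+ w)) :+ (con (+ 1) :+ K) :* (u₀ :+ t₀ :+ u₀)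
                            := (con (+ 1) :+ (K :+ K)) :* (u₀ :+ t₀ :+ u₀) :+ (K :+ K :+ K) :* t₀) refl

𝕋 : Series
𝕋 k = ℚof (centralTrinomial k)

ℚofℕ-suc : ∀ n → ℚofℕ (suc n) ≡ 1ℚ + ℚofℕ n
ℚofℕ-suc n = ℚof-+ (+ 1) (+ n)

𝕋-recurrence : ∀ k → let a = ℚofℕ (suc k) in
  ℚofℕ (suc (suc k)) * 𝕋 (suc (suc k)) ≡ (1ℚ + (a + a)) * 𝕋 (suc k) + (a + a + a) * 𝕋 k
𝕋-recurrence k = begin
  ℚofℕ (suc (suc k)) * 𝕋 (suc (suc k))                  ≡⟨ sym (ℚof-* (+ suc (suc k)) (centralTrinomial (suc (suc k)))) ⟩
  ℚof ((+ 1 ℤ.+ K) ℤ.* centralTrinomial (suc (suc k)))  ≡⟨ cong ℚof (centralTrinomial-recurrence k) ⟩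
  ℚof (c₁ ℤ.* centralTrinomial (suc k) ℤ.+ c₂ ℤ.* centralTrinomial k)
                                                        ≡⟨ trans (ℚof-+ (c₁ ℤ.* centralTrinomial (suc k)) (c₂ ℤ.* centralTrinomial k))
                                                                 (cong₂ _+_ (ℚof-* c₁ (centralTrinomial (suc k))) (ℚof-* c₂ (centralTrinomial k))) ⟩
  ℚof c₁ * 𝕋 (suc k) + ℚof c₂ * 𝕋 k                     ≡⟨ cong₂ (λ u v → u * 𝕋 (suc k) + v * 𝕋 k)
                                                                 (trans (ℚof-+ (+ 1) (K ℤ.+ K)) (cong (_+_ 1ℚ) (ℚof-+ K K)))
                                                                 (trans (ℚof-+ (K ℤ.+ K) K) (cong (_+ ℚofℕ (suc k)) (ℚof-+ K K))) ⟩
  (1ℚ + (a + a)) * 𝕋 (suc k) + (a + a + a) * 𝕋 k        ∎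
  where
  open ≡-Reasoning
  K = + suc k
  a = ℚofℕ (suc k)
  c₁ = + 1 ℤ.+ (K ℤ.+ K)
  c₂ = K ℤ.+ K ℤ.+ K

Dₛ Bₛ : Series
Dₛ = polyₛ (1ℚ ∷ ℚof -[1+ 1 ] ∷ ℚof -[1+ 2 ] ∷ [])
Bₛ = polyₛ (1ℚ ∷ ℚof (+ 3) ∷ [])

polyₛ-*ₛ-coeff₃ : ∀ a b c f m → (polyₛ (a ∷ b ∷ c ∷ []) *ₛ f) (suc (suc m)) ≡ a * f (suc (suc m)) + (b * f (suc m) + (c * f m + 0ℚ))
polyₛ-*ₛ-coeff₃ a b c f m = trans (*ₛ-coeff (polyₛ (a ∷ b ∷ c ∷ [])) f (suc (suc m)))
  (cong (λ z → a * f (suc (suc m)) + (b * f (suc m) + (c * f m + z))) (∑-zero m (λ i _ → ℚₚ.*-zeroˡ (f (m ∸ suc i)))))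

polyₛ-*ₛ-coeff₂ : ∀ a b f m → (polyₛ (a ∷ b ∷ []) *ₛ f) (suc (suc m)) ≡ a * f (suc (suc m)) + (b * f (suc m) + 0ℚ)
polyₛ-*ₛ-coeff₂ a b f m = trans (*ₛ-coeff (polyₛ (a ∷ b ∷ [])) f (suc (suc m)))
  (cong (λ z → a * f (suc (suc m)) + (b * f (suc m) + z)) (∑-zero (suc m) (λ i _ → ℚₚ.*-zeroˡ (f (suc m ∸ suc i)))))

𝕋-ode : (Dₛ *ₛ ∂ 𝕋) ≗ (Bₛ *ₛ 𝕋)
𝕋-ode zero          = refl
𝕋-ode (suc zero)    = refl
𝕋-ode (suc (suc m)) = begin
  (Dₛ *ₛ ∂ 𝕋) (suc (suc m))
    ≡⟨ polyₛ-*ₛ-coeff₃ 1ℚ (ℚof -[1+ 1 ]) (ℚof -[1+ 2 ]) (∂ 𝕋) m ⟩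
  1ℚ * (ℚofℕ (3 ℕ.+ m) * t₃) + (ℚof -[1+ 1 ] * (ℚofℕ (2 ℕ.+ m) * t₂) + (ℚof -[1+ 2 ] * (a * t₁) + 0ℚ))
    ≡⟨ cong₂ (λ u v → 1ℚ * u + (ℚof -[1+ 1 ] * (v * t₂) + (ℚof -[1+ 2 ] * (a * t₁) + 0ℚ)))
             (𝕋-recurrence (suc m)) (ℚofℕ-suc (suc m)) ⟩
  1ℚ * ((1ℚ + (b + b)) * t₂ + (b + b + b) * t₁) + (ℚof -[1+ 1 ] * ((1ℚ + a) * t₂) + (ℚof -[1+ 2 ] * (a * t₁) + 0ℚ))
    ≡⟨ cong (λ b → 1ℚ * ((1ℚ + (b + b)) * t₂ + (b + b + b) * t₁) + (ℚof -[1+ 1 ] * ((1ℚ + a) * t₂) + (ℚof -[1+ 2 ] * (a * t₁) + 0ℚ)))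
            (ℚofℕ-suc (suc m)) ⟩
  1ℚ * ((1ℚ + ((1ℚ + a) + (1ℚ + a))) * t₂ + ((1ℚ + a) + (1ℚ + a) + (1ℚ + a)) * t₁)
    + (ℚof -[1+ 1 ] * ((1ℚ + a) * t₂) + (ℚof -[1+ 2 ] * (a * t₁) + 0ℚ))
    ≡⟨ collect a t₁ t₂ ⟩
  1ℚ * t₂ + (ℚof (+ 3) * t₁ + 0ℚ)
    ≡⟨ sym (polyₛ-*ₛ-coeff₂ 1ℚ (ℚof (+ 3)) 𝕋 m) ⟩
  (Bₛ *ₛ 𝕋) (suc (suc m))
    ∎
  where
  open ≡-Reasoning
  open +-*-Solver
  a = ℚofℕ (suc m)
  b = ℚofℕ (suc (suc m))
  t₁ = 𝕋 (suc m)
  t₂ = 𝕋 (suc (suc m))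
  t₃ = 𝕋 (suc (suc (suc m)))
  collect : ∀ a t₁ t₂ →
    1ℚ * ((1ℚ + ((1ℚ + a) + (1ℚ + a))) * t₂ + ((1ℚ + a) + (1ℚ + a) + (1ℚ + a)) * t₁)
      + (ℚof -[1+ 1 ] * ((1ℚ + a) * t₂) + (ℚof -[1+ 2 ] * (a * t₁) + 0ℚ))
    ≡ 1ℚ * t₂ + (ℚof (+ 3) * t₁ + 0ℚ)
  collect = solve 3 (λ a t₁ t₂ →
    con 1ℚ :* ((con 1ℚ :+ ((con 1ℚ :+ a) :+ (con 1ℚ :+ a))) :* t₂ :+ ((con 1ℚ :+ a) :+ (con 1ℚ :+ a) :+ (con 1ℚ :+ a)) :* t₁)
      :+ (con (ℚof -[1+ 1 ]) :* ((con 1ℚ :+ a) :* t₂) :+ (con (ℚof -[1+ 2 ]) :* (a :* t₁) :+ con 0ℚ))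
    := con 1ℚ :* t₂ :+ (con (ℚof (+ 3)) :* t₁ :+ con 0ℚ)) refl

cₛ : ℤ → Series
cₛ z = constₛ (ℚof z)

horner : List ℚ → Series
horner []           = 0ₛ
horner (c ∷ [])     = constₛ c
horner (c ∷ c′ ∷ cs) = constₛ c +ₛ (Xₛ *ₛ horner (c′ ∷ cs))

polyₛ-∷ : ∀ c cs → polyₛ (c ∷ cs) ≗ (constₛ c +ₛ (Xₛ *ₛ polyₛ cs))
polyₛ-∷ c cs zero    = sym (trans (cong (_+_ c) (Xₛ-*ₛ (polyₛ cs) 0)) (ℚₚ.+-identityʳ c))
polyₛ-∷ c cs (suc n) = sym (trans (cong (_+_ 0ℚ) (Xₛ-*ₛ (polyₛ cs) (suc n))) (ℚₚ.+-identityˡ (polyₛ cs n)))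

polyₛ≋horner : ∀ cs → polyₛ cs ≋ horner cs
polyₛ≋horner []            = mk≋ (λ { zero → refl ; (suc n) → refl })
polyₛ≋horner (c ∷ [])      = Series.refl
polyₛ≋horner (c ∷ c′ ∷ cs) = Series.trans (mk≋ (polyₛ-∷ c (c′ ∷ cs)))
                                          (Series.+-cong (≋-refl (constₛ c)) (Series.*-cong (≋-refl Xₛ) (polyₛ≋horner (c′ ∷ cs))))

∂Dₛ : ∂ Dₛ ≗ polyₛ (ℚof -[1+ 1 ] ∷ ℚof -[1+ 5 ] ∷ [])
∂Dₛ zero          = refl
∂Dₛ (suc zero)    = refl
∂Dₛ (suc (suc n)) = ℚₚ.*-zeroʳ (ℚofℕ (3 ℕ.+ n))

-- (𝕋² D)′ = 2 𝕋 (D 𝕋′) + 𝕋² D′ = 𝕋² (2 (1 + 3t) + (-2 - 6t)) = 0, so 𝕋² D is constant.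
𝕋²Dₛ≋1 : ((𝕋 *ₛ 𝕋) *ₛ Dₛ) ≋ 1ₛ
𝕋²Dₛ≋1 = mk≋ (λ n → trans (∂≗0⇒constant ((𝕋 *ₛ 𝕋) *ₛ Dₛ) (coeff≡ derivative≋0) n) (constant≡1 n))
  where
  open import Relation.Binary.Reasoning.Setoid Series.setoid
  open SeriesSolver
  constant≡1 : constₛ (((𝕋 *ₛ 𝕋) *ₛ Dₛ) 0) ≗ 1ₛ
  constant≡1 zero    = refl
  constant≡1 (suc n) = refl
  derivative≋0 : ∂ ((𝕋 *ₛ 𝕋) *ₛ Dₛ) ≋ 0ₛ
  derivative≋0 = begin
    ∂ ((𝕋 *ₛ 𝕋) *ₛ Dₛ)
      ≈⟨ mk≋ (∂-*ₛ (𝕋 *ₛ 𝕋) Dₛ) ⟩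
    (∂ (𝕋 *ₛ 𝕋) *ₛ Dₛ) +ₛ ((𝕋 *ₛ 𝕋) *ₛ ∂ Dₛ)
      ≈⟨ Series.+-cong (Series.*-cong (mk≋ (∂-*ₛ 𝕋 𝕋)) (≋-refl Dₛ)) (≋-refl ((𝕋 *ₛ 𝕋) *ₛ ∂ Dₛ)) ⟩
    (((∂ 𝕋 *ₛ 𝕋) +ₛ (𝕋 *ₛ ∂ 𝕋)) *ₛ Dₛ) +ₛ ((𝕋 *ₛ 𝕋) *ₛ ∂ Dₛ)
      ≈⟨ solve 4 (λ t d D dD → ((d :* t :+ t :* d) :* D) :+ ((t :* t) :* dD) := ((t :+ t) :* (D :* d)) :+ ((t :* t) :* dD))
               Series.refl 𝕋 (∂ 𝕋) Dₛ (∂ Dₛ) ⟩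
    ((𝕋 +ₛ 𝕋) *ₛ (Dₛ *ₛ ∂ 𝕋)) +ₛ ((𝕋 *ₛ 𝕋) *ₛ ∂ Dₛ)
      ≈⟨ Series.+-cong (Series.*-cong (≋-refl (𝕋 +ₛ 𝕋)) (Series.trans (mk≋ 𝕋-ode) (Series.*-cong (polyₛ≋horner (1ℚ ∷ ℚof (+ 3) ∷ [])) (≋-refl 𝕋))))
                       (Series.*-cong (≋-refl (𝕋 *ₛ 𝕋)) (Series.trans (mk≋ ∂Dₛ) (polyₛ≋horner (ℚof -[1+ 1 ] ∷ ℚof -[1+ 5 ] ∷ [])))) ⟩
    ((𝕋 +ₛ 𝕋) *ₛ ((1ₛ +ₛ (Xₛ *ₛ cₛ (+ 3))) *ₛ 𝕋)) +ₛ ((𝕋 *ₛ 𝕋) *ₛ (cₛ -[1+ 1 ] +ₛ (Xₛ *ₛ cₛ -[1+ 5 ])))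
      ≈⟨ solve 2 (λ t X → ((t :+ t) :* ((con 1ℚ :+ (X :* con (ℚof (+ 3)))) :* t))
                            :+ ((t :* t) :* (con (ℚof -[1+ 1 ]) :+ (X :* con (ℚof -[1+ 5 ])))) := con 0ℚ)
               Series.refl 𝕋 Xₛ ⟩
    constₛ 0ℚ
      ≈⟨ mk≋ (λ { zero → refl ; (suc n) → refl }) ⟩
    0ₛ
      ∎

-- (d - p) (d + p) = 0, and d + p has an invertible constant term.
≋-square-root-unique : ∀ d p k → (d *ₛ d) ≋ (p *ₛ p) → (d 0 + p 0) * k ≡ 1ℚ → d ≋ p
≋-square-root-unique d p k d²≋p² unit = begin
  d                        ≈⟨ solve 2 (λ d p → d := (d :+ (:- p)) :+ p) Series.refl d p ⟩
  (d +ₛ (-ₛ p)) +ₛ p       ≈⟨ Series.+-cong (mk≋ d-p≗0) (≋-refl p) ⟩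
  0ₛ +ₛ p                  ≈⟨ Series.+-identityˡ p ⟩
  p                        ∎
  where
  open import Relation.Binary.Reasoning.Setoid Series.setoid
  open SeriesSolver
  product≋0 : ((d +ₛ (-ₛ p)) *ₛ (d +ₛ p)) ≋ 0ₛ
  product≋0 = begin
    (d +ₛ (-ₛ p)) *ₛ (d +ₛ p)   ≈⟨ solve 2 (λ d p → (d :+ (:- p)) :* (d :+ p) := (d :* d) :+ (:- (p :* p))) Series.refl d p ⟩
    (d *ₛ d) +ₛ (-ₛ (p *ₛ p))   ≈⟨ Series.+-cong d²≋p² (≋-refl (-ₛ (p *ₛ p))) ⟩
    (p *ₛ p) +ₛ (-ₛ (p *ₛ p))   ≈⟨ Series.-‿inverseʳ (p *ₛ p) ⟩
    0ₛ                          ∎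
  d-p≗0 : (d +ₛ (-ₛ p)) ≗ 0ₛ
  d-p≗0 = *ₛ-unit≗0⇒≗0 (d +ₛ (-ₛ p)) (d +ₛ p) k unit (coeff≡ product≋0)

invₛ-*ₛ-sqrtₛ : ∀ p f h → p 0 ≡ 1ℚ → (p *ₛ f) 0 ≡ 1ℚ → ((p *ₛ f) *ₛ (p *ₛ f)) ≗ h → (invₛ p *ₛ sqrtₛ h) ≋ f
invₛ-*ₛ-sqrtₛ p f h p₀≡1 pf₀≡1 [pf]²≗h = begin
  invₛ p *ₛ sqrtₛ h       ≈⟨ Series.*-cong (≋-refl (invₛ p)) (Series.sym (mk≋ (sqrtₛ-unique h (p *ₛ f) pf₀≡1 [pf]²≗h))) ⟩
  invₛ p *ₛ (p *ₛ f)      ≈⟨ solve 3 (λ i p f → i :* (p :* f) := (p :* i) :* f) Series.refl (invₛ p) p f ⟩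
  (p *ₛ invₛ p) *ₛ f      ≈⟨ Series.*-cong (mk≋ (*ₛ-invₛ p p₀≡1)) (≋-refl f) ⟩
  1ₛ *ₛ f                 ≈⟨ Series.*-identityˡ f ⟩
  f                       ∎
  where
  open import Relation.Binary.Reasoning.Setoid Series.setoid
  open SeriesSolver

-- Even and odd parts of 𝕋, as series in x = t²

𝔼 𝕆 : Series
𝔼 = evenₛ 𝕋
𝕆 = oddₛ 𝕋

Lₛ P²ₛ : Series
Lₛ  = 1ₛ +ₛ (Xₛ *ₛ cₛ -[1+ 2 ])
P²ₛ = 1ₛ +ₛ (Xₛ *ₛ (cₛ -[1+ 9 ] +ₛ (Xₛ *ₛ cₛ (+ 9))))

Pₛ-square : (Pₛ *ₛ Pₛ) ≋ P²ₛ
Pₛ-square = Series.trans (mk≋ (sqrtₛ-square _ refl)) (polyₛ≋horner (1ℚ ∷ ℚof -[1+ 9 ] ∷ ℚof (+ 9) ∷ []))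

-- even and odd parts of 𝕋²
𝔸 𝔹 : Series
𝔸 = (𝔼 *ₛ 𝔼) +ₛ (Xₛ *ₛ (𝕆 *ₛ 𝕆))
𝔹 = (𝔼 *ₛ 𝕆) +ₛ (𝕆 *ₛ 𝔼)

evenₛ-cong : ∀ {f g} → f ≋ g → evenₛ f ≋ evenₛ g
evenₛ-cong f≋g = mk≋ (λ n → coeff≡ f≋g (n ℕ.+ n))

oddₛ-cong : ∀ {f g} → f ≋ g → oddₛ f ≋ oddₛ g
oddₛ-cong f≋g = mk≋ (λ n → coeff≡ f≋g (suc (n ℕ.+ n)))

shiftₛ≋Xₛ-*ₛ : ∀ f → shiftₛ f ≋ (Xₛ *ₛ f)
shiftₛ≋Xₛ-*ₛ f = mk≋ (λ n → sym (Xₛ-*ₛ f n))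

evenₛ-*ₛ≋ : ∀ f g → evenₛ (f *ₛ g) ≋ ((evenₛ f *ₛ evenₛ g) +ₛ (Xₛ *ₛ (oddₛ f *ₛ oddₛ g)))
evenₛ-*ₛ≋ f g = Series.trans (mk≋ (evenₛ-*ₛ f g)) (Series.+-cong (≋-refl (evenₛ f *ₛ evenₛ g)) (shiftₛ≋Xₛ-*ₛ (oddₛ f *ₛ oddₛ g)))

evenₛ-Dₛ : evenₛ Dₛ ≋ Lₛ
evenₛ-Dₛ = Series.trans (mk≋ coeffs) (polyₛ≋horner (1ℚ ∷ ℚof -[1+ 2 ] ∷ []))
  where
  coeffs : evenₛ Dₛ ≗ polyₛ (1ℚ ∷ ℚof -[1+ 2 ] ∷ [])
  coeffs zero          = refl
  coeffs (suc zero)    = refl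
  coeffs (suc (suc n)) = cong (polyₛ (ℚof -[1+ 2 ] ∷ [])) (trans (ℕₚ.+-suc n (suc n)) (cong suc (ℕₚ.+-suc n n)))

oddₛ-Dₛ : oddₛ Dₛ ≋ cₛ -[1+ 1 ]
oddₛ-Dₛ = mk≋ coeffs
  where
  coeffs : oddₛ Dₛ ≗ cₛ -[1+ 1 ]
  coeffs zero    = refl
  coeffs (suc n) = cong (polyₛ (ℚof -[1+ 2 ] ∷ [])) (ℕₚ.+-suc n n)

evenₛ-𝕋²Dₛ : ((𝔸 *ₛ Lₛ) +ₛ (Xₛ *ₛ (𝔹 *ₛ cₛ -[1+ 1 ]))) ≋ 1ₛ
evenₛ-𝕋²Dₛ = begin
  (𝔸 *ₛ Lₛ) +ₛ (Xₛ *ₛ (𝔹 *ₛ cₛ -[1+ 1 ]))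
    ≈⟨ Series.sym (Series.+-cong (Series.*-cong (evenₛ-*ₛ≋ 𝕋 𝕋) evenₛ-Dₛ)
                                 (Series.*-cong (≋-refl Xₛ) (Series.*-cong (mk≋ (oddₛ-*ₛ 𝕋 𝕋)) oddₛ-Dₛ))) ⟩
  (evenₛ (𝕋 *ₛ 𝕋) *ₛ evenₛ Dₛ) +ₛ (Xₛ *ₛ (oddₛ (𝕋 *ₛ 𝕋) *ₛ oddₛ Dₛ))
    ≈⟨ Series.sym (evenₛ-*ₛ≋ (𝕋 *ₛ 𝕋) Dₛ) ⟩
  evenₛ ((𝕋 *ₛ 𝕋) *ₛ Dₛ)
    ≈⟨ evenₛ-cong 𝕋²Dₛ≋1 ⟩
  evenₛ 1ₛ
    ≈⟨ mk≋ (λ { zero → refl ; (suc n) → refl }) ⟩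
  1ₛ
    ∎
  where open import Relation.Binary.Reasoning.Setoid Series.setoid

oddₛ-𝕋²Dₛ : ((𝔸 *ₛ cₛ -[1+ 1 ]) +ₛ (𝔹 *ₛ Lₛ)) ≋ constₛ 0ℚ
oddₛ-𝕋²Dₛ = begin
  (𝔸 *ₛ cₛ -[1+ 1 ]) +ₛ (𝔹 *ₛ Lₛ)
    ≈⟨ Series.sym (Series.+-cong (Series.*-cong (evenₛ-*ₛ≋ 𝕋 𝕋) oddₛ-Dₛ) (Series.*-cong (mk≋ (oddₛ-*ₛ 𝕋 𝕋)) evenₛ-Dₛ)) ⟩
  (evenₛ (𝕋 *ₛ 𝕋) *ₛ oddₛ Dₛ) +ₛ (oddₛ (𝕋 *ₛ 𝕋) *ₛ evenₛ Dₛ)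
    ≈⟨ mk≋ (λ n → sym (oddₛ-*ₛ (𝕋 *ₛ 𝕋) Dₛ n)) ⟩
  oddₛ ((𝕋 *ₛ 𝕋) *ₛ Dₛ)
    ≈⟨ oddₛ-cong 𝕋²Dₛ≋1 ⟩
  oddₛ 1ₛ
    ≈⟨ mk≋ (λ { zero → refl ; (suc n) → refl }) ⟩
  constₛ 0ℚ
    ∎
  where open import Relation.Binary.Reasoning.Setoid Series.setoid

-- Both identities only involve 𝔹 = 2 𝔼 𝕆 and 𝔸 linearly; eliminating 𝔸 leaves 𝔹 (L² - 4x) = 2.
𝔼𝕆P²≋1 : ((𝔼 *ₛ 𝕆) *ₛ P²ₛ) ≋ 1ₛ
𝔼𝕆P²≋1 = begin
  (𝔼 *ₛ 𝕆) *ₛ P²ₛ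
    ≈⟨ solve 4 (λ A e o X → (e :* o) :* P² X := con ½ :* ((L X :* ((A :* con (ℚof -[1+ 1 ])) :+ (B e o :* L X)))
                                                          :+ (con (ℚof (+ 2)) :* ((A :* L X) :+ (X :* (B e o :* con (ℚof -[1+ 1 ])))))))
             Series.refl 𝔸 𝔼 𝕆 Xₛ ⟩
  constₛ ½ *ₛ ((Lₛ *ₛ ((𝔸 *ₛ cₛ -[1+ 1 ]) +ₛ (𝔹 *ₛ Lₛ))) +ₛ (cₛ (+ 2) *ₛ ((𝔸 *ₛ Lₛ) +ₛ (Xₛ *ₛ (𝔹 *ₛ cₛ -[1+ 1 ])))))
    ≈⟨ Series.*-cong (≋-refl (constₛ ½)) (Series.+-cong (Series.*-cong (≋-refl Lₛ) oddₛ-𝕋²Dₛ)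
                                                        (Series.*-cong (≋-refl (cₛ (+ 2))) evenₛ-𝕋²Dₛ)) ⟩
  constₛ ½ *ₛ ((Lₛ *ₛ constₛ 0ℚ) +ₛ (cₛ (+ 2) *ₛ 1ₛ))
    ≈⟨ solve 1 (λ X → con ½ :* ((L X :* con 0ℚ) :+ (con (ℚof (+ 2)) :* con 1ℚ)) := con 1ℚ) Series.refl Xₛ ⟩
  1ₛ
    ∎
  where
  open import Relation.Binary.Reasoning.Setoid Series.setoid
  open SeriesSolver
  L P² : ∀ {n} → Polynomial n → Polynomial n
  L X = con 1ℚ :+ (X :* con (ℚof -[1+ 2 ]))
  P² X = con 1ℚ :+ (X :* (con (ℚof -[1+ 9 ]) :+ (X :* con (ℚof (+ 9)))))
  B : ∀ {n} → Polynomial n → Polynomial n → Polynomial n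
  B e o = (e :* o) :+ (o :* e)

𝔸≋𝔼𝕆L : 𝔸 ≋ ((𝔼 *ₛ 𝕆) *ₛ Lₛ)
𝔸≋𝔼𝕆L = begin
  𝔸
    ≈⟨ solve 3 (λ e o X → (e :* e) :+ (X :* (o :* o))
                  := ((e :* o) :* L X) :+ (con (- ½) :* ((((e :* e) :+ (X :* (o :* o))) :* con (ℚof -[1+ 1 ])) :+ (B e o :* L X))))
             Series.refl 𝔼 𝕆 Xₛ ⟩
  ((𝔼 *ₛ 𝕆) *ₛ Lₛ) +ₛ (constₛ (- ½) *ₛ ((𝔸 *ₛ cₛ -[1+ 1 ]) +ₛ (𝔹 *ₛ Lₛ)))
    ≈⟨ Series.+-cong (≋-refl ((𝔼 *ₛ 𝕆) *ₛ Lₛ)) (Series.*-cong (≋-refl (constₛ (- ½))) oddₛ-𝕋²Dₛ) ⟩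
  ((𝔼 *ₛ 𝕆) *ₛ Lₛ) +ₛ (constₛ (- ½) *ₛ constₛ 0ℚ)
    ≈⟨ solve 2 (λ p X → (p :* L X) :+ (con (- ½) :* con 0ℚ) := p :* L X) Series.refl (𝔼 *ₛ 𝕆) Xₛ ⟩
  (𝔼 *ₛ 𝕆) *ₛ Lₛ
    ∎
  where
  open import Relation.Binary.Reasoning.Setoid Series.setoid
  open SeriesSolver
  L : ∀ {n} → Polynomial n → Polynomial n
  L X = con 1ℚ :+ (X :* con (ℚof -[1+ 2 ]))
  B : ∀ {n} → Polynomial n → Polynomial n → Polynomial n
  B e o = (e :* o) :+ (o :* e)

-- α = (P 𝔼)² and β = x (P 𝕆)² are the two roots of z² - (1 - 3x) z + x.
α β : Series
α = (Pₛ *ₛ 𝔼) *ₛ (Pₛ *ₛ 𝔼)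
β = Xₛ *ₛ ((Pₛ *ₛ 𝕆) *ₛ (Pₛ *ₛ 𝕆))

α+β≋L : (α +ₛ β) ≋ Lₛ
α+β≋L = begin
  α +ₛ β                          ≈⟨ solve 4 (λ p e o X → ((p :* e) :* (p :* e)) :+ (X :* ((p :* o) :* (p :* o)))
                                                        := (p :* p) :* ((e :* e) :+ (X :* (o :* o))))
                                             Series.refl Pₛ 𝔼 𝕆 Xₛ ⟩
  (Pₛ *ₛ Pₛ) *ₛ 𝔸                 ≈⟨ Series.*-cong Pₛ-square 𝔸≋𝔼𝕆L ⟩
  P²ₛ *ₛ ((𝔼 *ₛ 𝕆) *ₛ Lₛ)         ≈⟨ solve 3 (λ q r l → q :* (r :* l) := (r :* q) :* l) Series.refl P²ₛ (𝔼 *ₛ 𝕆) Lₛ ⟩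
  ((𝔼 *ₛ 𝕆) *ₛ P²ₛ) *ₛ Lₛ         ≈⟨ Series.*-cong 𝔼𝕆P²≋1 (≋-refl Lₛ) ⟩
  1ₛ *ₛ Lₛ                        ≈⟨ Series.*-identityˡ Lₛ ⟩
  Lₛ                              ∎
  where
  open import Relation.Binary.Reasoning.Setoid Series.setoid
  open SeriesSolver

α*β≋X : (α *ₛ β) ≋ Xₛ
α*β≋X = begin
  α *ₛ β                                      ≈⟨ solve 4 (λ p e o X → ((p :* e) :* (p :* e)) :* (X :* ((p :* o) :* (p :* o)))
                                                                    := X :* (((e :* o) :* (p :* p)) :* ((e :* o) :* (p :* p))))
                                                         Series.refl Pₛ 𝔼 𝕆 Xₛ ⟩
  Xₛ *ₛ (𝔼𝕆P² *ₛ 𝔼𝕆P²)                        ≈⟨ Series.*-cong (≋-refl Xₛ) (Series.*-cong 𝔼𝕆[PP]≋1 𝔼𝕆[PP]≋1) ⟩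
  Xₛ *ₛ (1ₛ *ₛ 1ₛ)                            ≈⟨ solve 1 (λ X → X :* (con 1ℚ :* con 1ℚ) := X) Series.refl Xₛ ⟩
  Xₛ                                          ∎
  where
  open import Relation.Binary.Reasoning.Setoid Series.setoid
  open SeriesSolver
  𝔼𝕆P² = (𝔼 *ₛ 𝕆) *ₛ (Pₛ *ₛ Pₛ)
  𝔼𝕆[PP]≋1 : 𝔼𝕆P² ≋ 1ₛ
  𝔼𝕆[PP]≋1 = Series.trans (Series.*-cong (≋-refl (𝔼 *ₛ 𝕆)) Pₛ-square) 𝔼𝕆P²≋1

α-β≋P : (α +ₛ (-ₛ β)) ≋ Pₛ
α-β≋P = ≋-square-root-unique (α +ₛ (-ₛ β)) Pₛ ½ square refl
  where
  open import Relation.Binary.Reasoning.Setoid Series.setoid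
  open SeriesSolver
  square : ((α +ₛ (-ₛ β)) *ₛ (α +ₛ (-ₛ β))) ≋ (Pₛ *ₛ Pₛ)
  square = begin
    (α +ₛ (-ₛ β)) *ₛ (α +ₛ (-ₛ β))               ≈⟨ solve 2 (λ a b → (a :+ (:- b)) :* (a :+ (:- b))
                                                                    := ((a :+ b) :* (a :+ b)) :+ (con (ℚof -[1+ 3 ]) :* (a :* b)))
                                                             Series.refl α β ⟩
    ((α +ₛ β) *ₛ (α +ₛ β)) +ₛ (cₛ -[1+ 3 ] *ₛ (α *ₛ β))
                                                 ≈⟨ Series.+-cong (Series.*-cong α+β≋L α+β≋L) (Series.*-cong (≋-refl (cₛ -[1+ 3 ])) α*β≋X) ⟩
    (Lₛ *ₛ Lₛ) +ₛ (cₛ -[1+ 3 ] *ₛ Xₛ)            ≈⟨ solve 1 (λ X → ((con 1ℚ :+ (X :* con (ℚof -[1+ 2 ]))) :* (con 1ℚ :+ (X :* con (ℚof -[1+ 2 ]))))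
                                                                   :+ (con (ℚof -[1+ 3 ]) :* X)
                                                                 := con 1ℚ :+ (X :* (con (ℚof -[1+ 9 ]) :+ (X :* con (ℚof (+ 9))))))
                                                          Series.refl Xₛ ⟩
    P²ₛ                                          ≈⟨ Series.sym Pₛ-square ⟩
    Pₛ *ₛ Pₛ                                     ∎

α≋½[L+P] : α ≋ (constₛ ½ *ₛ (Lₛ +ₛ Pₛ))
α≋½[L+P] = begin
  α                                             ≈⟨ solve 2 (λ a b → a := con ½ :* ((a :+ b) :+ (a :+ (:- b)))) Series.refl α β ⟩
  constₛ ½ *ₛ ((α +ₛ β) +ₛ (α +ₛ (-ₛ β)))       ≈⟨ Series.*-cong (≋-refl (constₛ ½)) (Series.+-cong α+β≋L α-β≋P) ⟩
  constₛ ½ *ₛ (Lₛ +ₛ Pₛ)                        ∎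
  where
  open import Relation.Binary.Reasoning.Setoid Series.setoid
  open SeriesSolver

β≋½[L-P] : β ≋ (constₛ ½ *ₛ (Lₛ +ₛ (-ₛ Pₛ)))
β≋½[L-P] = begin
  β                                             ≈⟨ solve 2 (λ a b → b := con ½ :* ((a :+ b) :+ (:- (a :+ (:- b))))) Series.refl α β ⟩
  constₛ ½ *ₛ ((α +ₛ β) +ₛ (-ₛ (α +ₛ (-ₛ β))))  ≈⟨ Series.*-cong (≋-refl (constₛ ½)) (Series.+-cong α+β≋L (Series.-‿cong α-β≋P)) ⟩
  constₛ ½ *ₛ (Lₛ +ₛ (-ₛ Pₛ))                   ∎
  where
  open import Relation.Binary.Reasoning.Setoid Series.setoid
  open SeriesSolver

constₛ-*ₛ : ∀ c f n → (constₛ c *ₛ f) n ≡ c * f n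
constₛ-*ₛ c f n = trans (*ₛ-coeff (constₛ c) f n)
  (trans (cong (_+_ (c * f n)) (∑-zero n (λ i _ → ℚₚ.*-zeroˡ (f (n ∸ suc i))))) (ℚₚ.+-identityʳ (c * f n)))

Lₛ≗one-3x : Lₛ ≗ one-3x
Lₛ≗one-3x = coeff≡ (Series.sym (polyₛ≋horner (1ℚ ∷ ℚof -[1+ 2 ] ∷ [])))

GFR0≗𝔼 : GFR0 ≗ 𝔼
GFR0≗𝔼 = coeff≡ (invₛ-*ₛ-sqrtₛ Pₛ 𝔼 _ refl refl square)
  where
  square : ((Pₛ *ₛ 𝔼) *ₛ (Pₛ *ₛ 𝔼)) ≗ scaleₛ ½ (one-3x +ₛ Pₛ)
  square n = trans (coeff≡ α≋½[L+P] n) (trans (constₛ-*ₛ ½ (Lₛ +ₛ Pₛ) n) (cong (λ z → ½ * (z + Pₛ n)) (Lₛ≗one-3x n)))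

-- The odd part is read off β = x (P 𝕆)², hence the division by x in GFA0.
GFA0≗𝕆 : GFA0 ≗ 𝕆
GFA0≗𝕆 = coeff≡ (invₛ-*ₛ-sqrtₛ Pₛ 𝕆 _ refl refl square)
  where
  square : ((Pₛ *ₛ 𝕆) *ₛ (Pₛ *ₛ 𝕆)) ≗ scaleₛ ½ (divX (one-3x -ₛ Pₛ))
  square n = trans (sym (Xₛ-*ₛ ((Pₛ *ₛ 𝕆) *ₛ (Pₛ *ₛ 𝕆)) (suc n)))
             (trans (coeff≡ β≋½[L-P] (suc n))
             (trans (constₛ-*ₛ ½ (Lₛ +ₛ (-ₛ Pₛ)) (suc n)) (cong (λ z → ½ * (z + - Pₛ (suc n))) (Lₛ≗one-3x (suc n)))))

-- Counting paths

count : (Path → Bool) → List Path → ℕ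
count P ps = length (filterᵇ P ps)

count-++ : ∀ P xs ys → count P (xs ++ ys) ≡ count P xs ℕ.+ count P ys
count-++ P xs ys = trans (cong length (filter-++ (λ p → T? (P p)) xs ys)) (length-++ (filterᵇ P xs))

count-map : ∀ P (f : Path → Path) xs → count P (map f xs) ≡ count (P ∘ f) xs
count-map P f []       = refl
count-map P f (x ∷ xs) with P (f x)
... | true  = cong suc (count-map P f xs)
... | false = count-map P f xs

count-cong : ∀ {P Q} xs → (∀ p → P p ≡ Q p) → count P xs ≡ count Q xs
count-cong {P} {Q} []       eq = refl
count-cong {P} {Q} (x ∷ xs) eq with P x | Q x | eq x
... | true  | true  | refl = cong suc (count-cong xs eq)
... | false | false | refl = count-cong xs eq

count-none : ∀ {P} xs → (∀ p → P p ≡ false) → count P xs ≡ 0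
count-none {P} xs none = trans (count-cong xs none) (lemma xs)
  where
  lemma : ∀ xs → count (λ _ → false) xs ≡ 0
  lemma []       = refl
  lemma (x ∷ xs) = lemma xs

count-pathsOfLength-suc : ∀ P k → let ps = pathsOfLength k in count P (pathsOfLength (suc k))
  ≡ count (P ∘ (E ∷_)) ps ℕ.+ (count (P ∘ (NE ∷_)) ps ℕ.+ (count (P ∘ (SE ∷_)) ps ℕ.+
      (count (P ∘ (N ∷_)) ps ℕ.+ (count (P ∘ (S ∷_)) ps ℕ.+ 0))))
count-pathsOfLength-suc P k = first E (first NE (first SE (first N (first S refl))))
  where
  ps = pathsOfLength k
  first : ∀ s {rest r} → count P rest ≡ r → count P (map (s ∷_) ps ++ rest) ≡ count (P ∘ (s ∷_)) ps ℕ.+ r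
  first s {rest} eq = trans (count-++ P (map (s ∷_) ps) rest) (cong₂ ℕ._+_ (count-map P (s ∷_) ps) eq)

-- admissible true n m and admissible false n m are the predicates counted by AHR n m and AH n m.
admissible : Bool → ℕ → ℤ → Path → Bool
admissible b n m p = vConstrained p ∧ ((if b then firstInSM p else true) ∧ endsAt n m p)

private
  shift-≟ : ∀ a y m → ⌊ a ℤ.+ y ℤ.≟ m ⌋ ≡ ⌊ y ℤ.≟ ℤ.- a ℤ.+ m ⌋
  shift-≟ a y m = trans (isYes≗does (a ℤ.+ y ℤ.≟ m))
                 (trans (does-⇔ (mk⇔ to from) (a ℤ.+ y ℤ.≟ m) (y ℤ.≟ ℤ.- a ℤ.+ m)) (sym (isYes≗does (y ℤ.≟ ℤ.- a ℤ.+ m))))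
    where
    open ℤ-Solver.+-*-Solver
    to : a ℤ.+ y ≡ m → y ≡ ℤ.- a ℤ.+ m
    to refl = solve 2 (λ a y → y := (:- a) :+ (a :+ y)) refl a y
    from : y ≡ ℤ.- a ℤ.+ m → a ℤ.+ y ≡ m
    from refl = solve 2 (λ a m → a :+ ((:- a) :+ m) := m) refl a m

endsAt-∷ : ∀ s n m p → endsAt n m (s ∷ p) ≡ (dx s ℕ.+ endX p ≡ᵇ n) ∧ ⌊ endY p ℤ.≟ ℤ.- dy s ℤ.+ m ⌋
endsAt-∷ s n m p = cong (_∧_ (dx s ℕ.+ endX p ≡ᵇ n)) (shift-≟ (dy s) (endY p) m)

vConstrained-horizontal : ∀ s → vertical s ≡ false → ∀ p → vConstrained (s ∷ p) ≡ vConstrained p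
vConstrained-horizontal E  _ []      = refl
vConstrained-horizontal E  _ (_ ∷ _) = refl
vConstrained-horizontal NE _ []      = refl
vConstrained-horizontal NE _ (_ ∷ _) = refl
vConstrained-horizontal SE _ []      = refl
vConstrained-horizontal SE _ (_ ∷ _) = refl

vConstrained-vertical : ∀ s → vertical s ≡ true → ∀ p → vConstrained (s ∷ p) ≡ firstInSM p ∧ vConstrained p
vConstrained-vertical N _ []      = refl
vConstrained-vertical N _ (_ ∷ _) = refl
vConstrained-vertical S _ []      = refl
vConstrained-vertical S _ (_ ∷ _) = refl

admissible-horizontal : ∀ s → vertical s ≡ false → ∀ n m p →
                        admissible true (suc n) m (s ∷ p) ≡ admissible false n (ℤ.- dy s ℤ.+ m) p
admissible-horizontal E  refl n m p = cong₂ _∧_ (vConstrained-horizontal E refl p) (endsAt-∷ E (suc n) m p)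
admissible-horizontal NE refl n m p = cong₂ _∧_ (vConstrained-horizontal NE refl p) (endsAt-∷ NE (suc n) m p)
admissible-horizontal SE refl n m p = cong₂ _∧_ (vConstrained-horizontal SE refl p) (endsAt-∷ SE (suc n) m p)
admissible-horizontal-zero : ∀ s → vertical s ≡ false → ∀ m p → admissible true zero m (s ∷ p) ≡ false
admissible-horizontal-zero E  refl m p = Boolₚ.∧-zeroʳ (vConstrained (E ∷ p))
admissible-horizontal-zero NE refl m p = Boolₚ.∧-zeroʳ (vConstrained (NE ∷ p))
admissible-horizontal-zero SE refl m p = Boolₚ.∧-zeroʳ (vConstrained (SE ∷ p))

admissible-horizontal-unrestricted : ∀ s → vertical s ≡ false → ∀ n m p →
                                     admissible false n m (s ∷ p) ≡ admissible true n m (s ∷ p)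
admissible-horizontal-unrestricted E  refl n m p = refl
admissible-horizontal-unrestricted NE refl n m p = refl
admissible-horizontal-unrestricted SE refl n m p = refl

admissible-vertical-restricted : ∀ s → vertical s ≡ true → ∀ n m p → admissible true n m (s ∷ p) ≡ false
admissible-vertical-restricted N refl n m p = Boolₚ.∧-zeroʳ (vConstrained (N ∷ p))
admissible-vertical-restricted S refl n m p = Boolₚ.∧-zeroʳ (vConstrained (S ∷ p))

private
  ∧-regroup : ∀ {c e e′} f v → c ≡ f ∧ v → e ≡ e′ → c ∧ e ≡ v ∧ (f ∧ e′)
  ∧-regroup {e′ = e′} f v refl refl = trans (cong (_∧ e′) (Boolₚ.∧-comm f v)) (Boolₚ.∧-assoc v f e′)

admissible-vertical : ∀ s → vertical s ≡ true → ∀ n m p →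
                      admissible false n m (s ∷ p) ≡ admissible true n (ℤ.- dy s ℤ.+ m) p
admissible-vertical N refl n m p = ∧-regroup (firstInSM p) (vConstrained p) (vConstrained-vertical N refl p) (endsAt-∷ N n m p)
admissible-vertical S refl n m p = ∧-regroup (firstInSM p) (vConstrained p) (vConstrained-vertical S refl p) (endsAt-∷ S n m p)

countLength : ℕ → Bool → ℕ → ℤ → ℕ
countLength k b n m = count (admissible b n m) (pathsOfLength k)

-- multiplication of a Laurent polynomial in y by y⁻¹ + 1 + y, on coefficients
trinomialStep : (ℤ → ℕ) → ℤ → ℕ
trinomialStep f m = f (ℤ.pred m) ℕ.+ f m ℕ.+ f (ℤ.suc m)

countLength-restricted-suc : ∀ k n m → countLength (suc k) true (suc n) m ≡ trinomialStep (λ x → countLength k false n x) m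
countLength-restricted-suc k n m = begin
  countLength (suc k) true (suc n) m
    ≡⟨ count-pathsOfLength-suc (admissible true (suc n) m) k ⟩
  c E ℕ.+ (c NE ℕ.+ (c SE ℕ.+ (c N ℕ.+ (c S ℕ.+ 0))))
    ≡⟨ cong₂ ℕ._+_ (trans (horizontalStep E refl) (cong f (ℤₚ.+-identityˡ m)))
         (cong₂ ℕ._+_ (horizontalStep NE refl) (cong₂ ℕ._+_ (horizontalStep SE refl) (cong₂ ℕ._+_ (verticalStep N refl) (cong (ℕ._+ 0) (verticalStep S refl))))) ⟩
  f m ℕ.+ (f (ℤ.pred m) ℕ.+ (f (ℤ.suc m) ℕ.+ (0 ℕ.+ (0 ℕ.+ 0))))
    ≡⟨ solve 3 (λ a b c → a :+ (b :+ (c :+ (con 0 :+ (con 0 :+ con 0)))) := b :+ a :+ c) refl (f m) (f (ℤ.pred m)) (f (ℤ.suc m)) ⟩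
  trinomialStep f m
    ∎
  where
  open ≡-Reasoning
  open ℕ-Solver.+-*-Solver
  ps = pathsOfLength k
  f = λ x → countLength k false n x
  c : Step → ℕ
  c s = count (admissible true (suc n) m ∘ (s ∷_)) ps
  horizontalStep : ∀ s (hs : vertical s ≡ false) → c s ≡ f (ℤ.- dy s ℤ.+ m)
  horizontalStep s hs = count-cong ps (admissible-horizontal s hs n m)
  verticalStep : ∀ s (vs : vertical s ≡ true) → c s ≡ 0
  verticalStep s vs = count-none ps (admissible-vertical-restricted s vs (suc n) m)

countLength-restricted-zero : ∀ k m → countLength (suc k) true zero m ≡ 0
countLength-restricted-zero k m = trans (count-pathsOfLength-suc (admissible true zero m) k)
  (cong₂ ℕ._+_ (horizontalStep E refl) (cong₂ ℕ._+_ (horizontalStep NE refl) (cong₂ ℕ._+_ (horizontalStep SE refl)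
    (cong₂ ℕ._+_ (verticalStep N refl) (cong (ℕ._+ 0) (verticalStep S refl))))))
  where
  ps = pathsOfLength k
  horizontalStep : ∀ s (hs : vertical s ≡ false) → count (admissible true zero m ∘ (s ∷_)) ps ≡ 0
  horizontalStep s hs = count-none ps (admissible-horizontal-zero s hs m)
  verticalStep : ∀ s (vs : vertical s ≡ true) → count (admissible true zero m ∘ (s ∷_)) ps ≡ 0
  verticalStep s vs = count-none ps (admissible-vertical-restricted s vs zero m)

-- An unrestricted path starts either with a step of S_M or with a vertical step followed by a restricted path.
countLength-unrestricted-suc : ∀ k n m → countLength (suc k) false n m
  ≡ countLength (suc k) true n m ℕ.+ (countLength k true n (ℤ.pred m) ℕ.+ countLength k true n (ℤ.suc m))
countLength-unrestricted-suc k n m = begin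
  countLength (suc k) false n m
    ≡⟨ count-pathsOfLength-suc (admissible false n m) k ⟩
  u E ℕ.+ (u NE ℕ.+ (u SE ℕ.+ (u N ℕ.+ (u S ℕ.+ 0))))
    ≡⟨ cong₂ ℕ._+_ (horizontalStep E refl) (cong₂ ℕ._+_ (horizontalStep NE refl) (cong₂ ℕ._+_ (horizontalStep SE refl)
         (cong₂ ℕ._+_ (verticalStep N refl) (cong (ℕ._+ 0) (verticalStep S refl))))) ⟩
  r E ℕ.+ (r NE ℕ.+ (r SE ℕ.+ (g (ℤ.pred m) ℕ.+ (g (ℤ.suc m) ℕ.+ 0))))
    ≡⟨ solve 5 (λ a b c d e → a :+ (b :+ (c :+ (d :+ (e :+ con 0)))) := (a :+ (b :+ (c :+ (con 0 :+ (con 0 :+ con 0))))) :+ (d :+ e))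
             refl (r E) (r NE) (r SE) (g (ℤ.pred m)) (g (ℤ.suc m)) ⟩
  (r E ℕ.+ (r NE ℕ.+ (r SE ℕ.+ (0 ℕ.+ (0 ℕ.+ 0))))) ℕ.+ (g (ℤ.pred m) ℕ.+ g (ℤ.suc m))
    ≡⟨ cong (ℕ._+ (g (ℤ.pred m) ℕ.+ g (ℤ.suc m))) (sym (trans (count-pathsOfLength-suc (admissible true n m) k)
         (cong (ℕ._+_ (r E)) (cong (ℕ._+_ (r NE)) (cong (ℕ._+_ (r SE)) (cong₂ ℕ._+_ (restricted N refl) (cong (ℕ._+ 0) (restricted S refl)))))))) ⟩
  countLength (suc k) true n m ℕ.+ (g (ℤ.pred m) ℕ.+ g (ℤ.suc m))
    ∎
  where
  open ≡-Reasoning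
  open ℕ-Solver.+-*-Solver
  ps = pathsOfLength k
  g = λ x → countLength k true n x
  u r : Step → ℕ
  u s = count (admissible false n m ∘ (s ∷_)) ps
  r s = count (admissible true n m ∘ (s ∷_)) ps
  horizontalStep : ∀ s (hs : vertical s ≡ false) → u s ≡ r s
  horizontalStep s hs = count-cong ps (admissible-horizontal-unrestricted s hs n m)
  verticalStep : ∀ s (vs : vertical s ≡ true) → u s ≡ g (ℤ.- dy s ℤ.+ m)
  verticalStep s vs = count-cong ps (admissible-vertical s vs n m)
  restricted : ∀ s (vs : vertical s ≡ true) → r s ≡ 0
  restricted s vs = count-none ps (admissible-vertical-restricted s vs n m)

count-singleton : ∀ P p → count P (p ∷ []) ≡ (if P p then 1 else 0)
count-singleton P p with P p
... | true  = refl
... | false = refl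

⌊≟⌋-sym : ∀ a b → ⌊ a ℤ.≟ b ⌋ ≡ ⌊ b ℤ.≟ a ⌋
⌊≟⌋-sym a b = trans (isYes≗does (a ℤ.≟ b)) (trans (does-⇔ (mk⇔ sym sym) (a ℤ.≟ b) (b ℤ.≟ a)) (sym (isYes≗does (b ℤ.≟ a))))

countLength-empty : ∀ m → countLength 0 true zero m ≡ trinomial 0 m
countLength-empty m = trans (count-singleton (admissible true zero m) [])
                            (cong (λ b → if b then 1 else 0) (⌊≟⌋-sym (+ 0) m))

countLength-restricted-vanishes   : ∀ k n m → n ℕ.+ n < k → countLength k true n m ≡ 0
countLength-unrestricted-vanishes : ∀ k n m → suc (n ℕ.+ n) < k → countLength k false n m ≡ 0

countLength-restricted-vanishes (suc k) zero    m _         = countLength-restricted-zero k m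
countLength-restricted-vanishes (suc k) (suc n) m (s≤s 2n+1<k) = trans (countLength-restricted-suc k n m)
  (cong₂ ℕ._+_ (cong₂ ℕ._+_ (vanishes (ℤ.pred m)) (vanishes m)) (vanishes (ℤ.suc m)))
  where
  vanishes : ∀ x → countLength k false n x ≡ 0
  vanishes x = countLength-unrestricted-vanishes k n x (subst (_< k) (ℕₚ.+-suc n n) 2n+1<k)

countLength-unrestricted-vanishes (suc k) n m (s≤s 2n<k) = trans (countLength-unrestricted-suc k n m)
  (cong₂ ℕ._+_ (countLength-restricted-vanishes (suc k) n m (ℕₚ.m≤n⇒m≤1+n 2n<k))
               (cong₂ ℕ._+_ (countLength-restricted-vanishes k n (ℤ.pred m) 2n<k)
                            (countLength-restricted-vanishes k n (ℤ.suc m) 2n<k)))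

∑ℕ : (ℕ → ℕ) → ℕ → ℕ
∑ℕ f zero    = 0
∑ℕ f (suc L) = f 0 ℕ.+ ∑ℕ (f ∘ suc) L

∑ℕ-cong : ∀ {f g} L → (∀ l → f l ≡ g l) → ∑ℕ f L ≡ ∑ℕ g L
∑ℕ-cong zero    eq = refl
∑ℕ-cong (suc L) eq = cong₂ ℕ._+_ (eq 0) (∑ℕ-cong L (eq ∘ suc))

∑ℕ-+ : ∀ f g L → ∑ℕ (λ l → f l ℕ.+ g l) L ≡ ∑ℕ f L ℕ.+ ∑ℕ g L
∑ℕ-+ f g zero    = refl
∑ℕ-+ f g (suc L) = trans (cong (ℕ._+_ (f 0 ℕ.+ g 0)) (∑ℕ-+ (f ∘ suc) (g ∘ suc) L))
                         (solve 4 (λ a b c d → a :+ b :+ (c :+ d) := a :+ c :+ (b :+ d)) refl (f 0) (g 0) (∑ℕ (f ∘ suc) L) (∑ℕ (g ∘ suc) L))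
  where open ℕ-Solver.+-*-Solver

∑ℕ-trinomialStep : ∀ (F : ℕ → ℤ → ℕ) L m → ∑ℕ (λ l → trinomialStep (F l) m) L ≡ trinomialStep (λ x → ∑ℕ (λ l → F l x) L) m
∑ℕ-trinomialStep F L m = trans (∑ℕ-+ (λ l → F l (ℤ.pred m) ℕ.+ F l m) (λ l → F l (ℤ.suc m)) L)
                               (cong (ℕ._+ ∑ℕ (λ l → F l (ℤ.suc m)) L) (∑ℕ-+ (λ l → F l (ℤ.pred m)) (λ l → F l m) L))

∑ℕ-vanishing-last : ∀ f L → f L ≡ 0 → ∑ℕ f (suc L) ≡ ∑ℕ f L
∑ℕ-vanishing-last f zero    f₀≡0 = trans (ℕₚ.+-identityʳ (f 0)) f₀≡0
∑ℕ-vanishing-last f (suc L) fL≡0 = cong (ℕ._+_ (f 0)) (∑ℕ-vanishing-last (f ∘ suc) L fL≡0)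

countLen-applyUpTo : ∀ P (g : ℕ → ℕ) L → countLen P (applyUpTo g L) ≡ ∑ℕ (λ l → count P (pathsOfLength (g l))) L
countLen-applyUpTo P g zero    = refl
countLen-applyUpTo P g (suc L) = cong (ℕ._+_ (count P (pathsOfLength (g 0)))) (countLen-applyUpTo P (g ∘ suc) L)

-- All admissible paths to abscissa n have at most 2n + 1 steps, the range counted by countPaths.
total : Bool → ℕ → ℤ → ℕ
total b n m = ∑ℕ (λ l → countLength l b n m) (suc (suc (n ℕ.+ n)))

countPaths≡total : ∀ b n m → countPaths n (admissible b n m) ≡ total b n m
countPaths≡total b n m = trans (countLen-applyUpTo (admissible b n m) (λ l → l) (suc (2 ℕ.* n ℕ.+ 1)))
                               (cong (∑ℕ (λ l → countLength l b n m)) (double n))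
  where
  double : ∀ n → suc (2 ℕ.* n ℕ.+ 1) ≡ suc (suc (n ℕ.+ n))
  double = solve 1 (λ n → con 1 :+ (con 2 :* n :+ con 1) := con 1 :+ (con 1 :+ (n :+ n))) refl
    where open ℕ-Solver.+-*-Solver

trinomialStep-cong : ∀ {f g} m → (∀ x → f x ≡ g x) → trinomialStep f m ≡ trinomialStep g m
trinomialStep-cong m eq = cong₂ ℕ._+_ (cong₂ ℕ._+_ (eq (ℤ.pred m)) (eq m)) (eq (ℤ.suc m))

total-restricted-zero : ∀ m → total true zero m ≡ trinomial 0 m
total-restricted-zero m = trans (cong₂ ℕ._+_ (countLength-empty m) (cong (ℕ._+ 0) (countLength-restricted-zero 0 m)))
                                (ℕₚ.+-identityʳ (trinomial 0 m))

total-restricted-suc : ∀ n m → total true (suc n) m ≡ trinomialStep (total false n) m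
total-restricted-suc n m = begin
  ∑ℕ (λ l → countLength l true (suc n) m) (suc (suc (suc n ℕ.+ suc n)))
    ≡⟨ cong (λ L → ∑ℕ (λ l → countLength (suc l) true (suc n) m) (suc L)) (ℕₚ.+-suc (suc n) n) ⟩
  ∑ℕ (λ l → countLength (suc l) true (suc n) m) (suc (suc (suc (n ℕ.+ n))))
    ≡⟨ ∑ℕ-cong (suc (suc (suc (n ℕ.+ n)))) (λ l → countLength-restricted-suc l n m) ⟩
  ∑ℕ (λ l → trinomialStep (λ x → countLength l false n x) m) (suc (suc (suc (n ℕ.+ n))))
    ≡⟨ ∑ℕ-trinomialStep (λ l x → countLength l false n x) (suc (suc (suc (n ℕ.+ n)))) m ⟩
  trinomialStep (λ x → ∑ℕ (λ l → countLength l false n x) (suc (suc (suc (n ℕ.+ n))))) m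
    ≡⟨ trinomialStep-cong m (λ x → ∑ℕ-vanishing-last (λ l → countLength l false n x) (suc (suc (n ℕ.+ n)))
                                     (countLength-unrestricted-vanishes _ n x ℕₚ.≤-refl)) ⟩
  trinomialStep (total false n) m
    ∎
  where open ≡-Reasoning

countLength-empty-unrestricted : ∀ n m → countLength 0 false n m ≡ countLength 0 true n m
countLength-empty-unrestricted n m = trans (count-singleton (admissible false n m) [])
                                            (sym (count-singleton (admissible true n m) []))

total-unrestricted-step : ∀ n m → total false n m ≡ trinomialStep (total true n) m
total-unrestricted-step n m = begin
  ∑ℕ (λ l → countLength l false n m) (suc L)
    ≡⟨ cong₂ ℕ._+_ (countLength-empty-unrestricted n m) (∑ℕ-cong L (λ l → countLength-unrestricted-suc l n m)) ⟩
  countLength 0 true n m ℕ.+ ∑ℕ (λ l → countLength (suc l) true n m ℕ.+ (c l (ℤ.pred m) ℕ.+ c l (ℤ.suc m))) L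
    ≡⟨ cong (ℕ._+_ (countLength 0 true n m)) (trans (∑ℕ-+ (λ l → countLength (suc l) true n m) (λ l → c l (ℤ.pred m) ℕ.+ c l (ℤ.suc m)) L)
                                                    (cong (ℕ._+_ (∑ℕ (λ l → countLength (suc l) true n m) L))
                                                          (∑ℕ-+ (λ l → c l (ℤ.pred m)) (λ l → c l (ℤ.suc m)) L))) ⟩
  countLength 0 true n m ℕ.+ (∑ℕ (λ l → countLength (suc l) true n m) L ℕ.+ (short (ℤ.pred m) ℕ.+ short (ℤ.suc m)))
    ≡⟨ sym (ℕₚ.+-assoc (countLength 0 true n m) (∑ℕ (λ l → countLength (suc l) true n m) L) (short (ℤ.pred m) ℕ.+ short (ℤ.suc m))) ⟩
  total true n m ℕ.+ (short (ℤ.pred m) ℕ.+ short (ℤ.suc m))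
    ≡⟨ cong₂ (λ a b → total true n m ℕ.+ (a ℕ.+ b)) (all (ℤ.pred m)) (all (ℤ.suc m)) ⟩
  total true n m ℕ.+ (total true n (ℤ.pred m) ℕ.+ total true n (ℤ.suc m))
    ≡⟨ solve 3 (λ a b c → a :+ (b :+ c) := b :+ a :+ c) refl (total true n m) (total true n (ℤ.pred m)) (total true n (ℤ.suc m)) ⟩
  trinomialStep (total true n) m
    ∎
  where
  open ≡-Reasoning
  open ℕ-Solver.+-*-Solver
  L = suc (n ℕ.+ n)
  c : ℕ → ℤ → ℕ
  c l x = countLength l true n x
  short : ℤ → ℕ
  short x = ∑ℕ (λ l → c l x) L
  all : ∀ x → short x ≡ total true n x
  all x = sym (∑ℕ-vanishing-last (λ l → c l x) L (countLength-restricted-vanishes L n x ℕₚ.≤-refl))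

total-restricted≡trinomial : ∀ n m → total true n m ≡ trinomial (n ℕ.+ n) m
total-unrestricted≡trinomial : ∀ n m → total false n m ≡ trinomial (suc (n ℕ.+ n)) m

total-restricted≡trinomial zero    m = total-restricted-zero m
total-restricted≡trinomial (suc n) m = trans (total-restricted-suc n m)
  (trans (trinomialStep-cong m (total-unrestricted≡trinomial n)) (cong (λ k → trinomial k m) (sym (ℕₚ.+-suc (suc n) n))))

total-unrestricted≡trinomial n m = trans (total-unrestricted-step n m) (trinomialStep-cong m (total-restricted≡trinomial n))

AHR≡trinomial : ∀ n m → AHR n m ≡ trinomial (n ℕ.+ n) m
AHR≡trinomial n m = trans (countPaths≡total true n m) (total-restricted≡trinomial n m)

AH≡trinomial : ∀ n m → AH n m ≡ trinomial (suc (n ℕ.+ n)) m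
AH≡trinomial n m = trans (countPaths≡total false n m) (total-unrestricted≡trinomial n m)

-- The bivariate generating functions

⊛-cong : ∀ (p : Poly) {G G′ : BiSeries} → (∀ a b → G a b ≡ G′ a b) → ∀ n m → (p ⊛ G) n m ≡ (p ⊛ G′) n m
⊛-cong []                {G} {G′} eq n m = refl
⊛-cong ((i , j , c) ∷ p) {G} {G′} eq n m = cong₂ ℤ._+_ (term (i ℕ.≤ᵇ n)) (⊛-cong p eq n m)
  where
  term : ∀ b → (if b then c ℤ.* G (n ∸ i) (m ℤ.- j) else + 0) ≡ (if b then c ℤ.* G′ (n ∸ i) (m ℤ.- j) else + 0)
  term true  = cong (c ℤ.*_) (eq (n ∸ i) (m ℤ.- j))
  term false = refl

-- [yᵐ] of (1 + y + y²)² g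
Q²-coeff : (ℤ → ℤ) → ℤ → ℤ
Q²-coeff g m = (g (m ℤ.- + 4) ℤ.+ g (m ℤ.- + 3) ℤ.+ g (m ℤ.- + 2))
           ℤ.+ (g (m ℤ.- + 3) ℤ.+ g (m ℤ.- + 2) ℤ.+ g (m ℤ.- + 1))
           ℤ.+ (g (m ℤ.- + 2) ℤ.+ g (m ℤ.- + 1) ℤ.+ g (m ℤ.- + 0))

Den-⊛-zero : ∀ G m → (Den ⊛ G) zero m ≡ G zero (m ℤ.- + 2)
Den-⊛-zero G m = trans (ℤₚ.+-identityʳ _) (ℤₚ.*-identityˡ (G zero (m ℤ.- + 2)))

Den-⊛-suc : ∀ G n m → (Den ⊛ G) (suc n) m ≡ G (suc n) (m ℤ.- + 2) ℤ.- Q²-coeff (G n) m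
Den-⊛-suc G n m = collect (G (suc n) (m ℤ.- + 2)) (g (+ 0)) (g (+ 1)) (g (+ 2)) (g (+ 3)) (g (+ 4))
  where
  open ℤ-Solver.+-*-Solver
  g : ℤ → ℤ
  g j = G n (m ℤ.- j)
  collect : ∀ x a₀ a₁ a₂ a₃ a₄ →
    + 1 ℤ.* x ℤ.+ (-[1+ 0 ] ℤ.* a₀ ℤ.+ (-[1+ 0 ] ℤ.* a₁ ℤ.+ (-[1+ 0 ] ℤ.* a₂ ℤ.+ (-[1+ 0 ] ℤ.* a₁ ℤ.+ (-[1+ 0 ] ℤ.* a₂
      ℤ.+ (-[1+ 0 ] ℤ.* a₃ ℤ.+ (-[1+ 0 ] ℤ.* a₂ ℤ.+ (-[1+ 0 ] ℤ.* a₃ ℤ.+ (-[1+ 0 ] ℤ.* a₄ ℤ.+ + 0)))))))))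
    ≡ x ℤ.- ((a₄ ℤ.+ a₃ ℤ.+ a₂) ℤ.+ (a₃ ℤ.+ a₂ ℤ.+ a₁) ℤ.+ (a₂ ℤ.+ a₁ ℤ.+ a₀))
  collect = solve 6 (λ x a₀ a₁ a₂ a₃ a₄ →
    con (+ 1) :* x :+ (con -[1+ 0 ] :* a₀ :+ (con -[1+ 0 ] :* a₁ :+ (con -[1+ 0 ] :* a₂ :+ (con -[1+ 0 ] :* a₁ :+ (con -[1+ 0 ] :* a₂
      :+ (con -[1+ 0 ] :* a₃ :+ (con -[1+ 0 ] :* a₂ :+ (con -[1+ 0 ] :* a₃ :+ (con -[1+ 0 ] :* a₄ :+ con (+ 0))))))))))
    := x :- ((a₄ :+ a₃ :+ a₂) :+ (a₃ :+ a₂ :+ a₁) :+ (a₂ :+ a₁ :+ a₀))) refl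

private
  pred-minus-2 : ∀ m → ℤ.pred (m ℤ.- + 2) ≡ m ℤ.- + 3
  pred-minus-2 = solve 1 (λ m → con ℤ.-1ℤ :+ (m :- con (+ 2)) := m :- con (+ 3)) refl
    where open ℤ-Solver.+-*-Solver

  suc-minus-2 : ∀ m → ℤ.suc (m ℤ.- + 2) ≡ m ℤ.- + 1
  suc-minus-2 = solve 1 (λ m → con ℤ.1ℤ :+ (m :- con (+ 2)) := m :- con (+ 1)) refl
    where open ℤ-Solver.+-*-Solver

trinomial-suc-suc : ∀ k m → trinomialℤ (suc (suc k)) (m ℤ.- + 2) ≡ Q²-coeff (trinomialℤ k) m
trinomial-suc-suc k m =
  cong₂ ℤ._+_ (cong₂ ℤ._+_ (cong₂ ℤ._+_ (cong₂ ℤ._+_ (cong w pp) (cong w p)) (cong w sp))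
                           (cong₂ ℤ._+_ (cong₂ ℤ._+_ (cong w p) (refl {x = w (m ℤ.- + 2)})) (cong w s)))
              (cong₂ ℤ._+_ (cong₂ ℤ._+_ (cong w ps) (cong w s)) (cong w ss))
  where
  open ℤ-Solver.+-*-Solver
  w = trinomialℤ k
  pp : ℤ.pred (ℤ.pred (m ℤ.- + 2)) ≡ m ℤ.- + 4
  pp = solve 1 (λ m → con ℤ.-1ℤ :+ (con ℤ.-1ℤ :+ (m :- con (+ 2))) := m :- con (+ 4)) refl m
  p = pred-minus-2 m
  sp : ℤ.suc (ℤ.pred (m ℤ.- + 2)) ≡ m ℤ.- + 2
  sp = ℤₚ.suc-pred (m ℤ.- + 2)
  s = suc-minus-2 m
  ps : ℤ.pred (ℤ.suc (m ℤ.- + 2)) ≡ m ℤ.- + 2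
  ps = ℤₚ.pred-suc (m ℤ.- + 2)
  ss : ℤ.suc (ℤ.suc (m ℤ.- + 2)) ≡ m ℤ.- + 0
  ss = solve 1 (λ m → con ℤ.1ℤ :+ (con ℤ.1ℤ :+ (m :- con (+ 2))) := m :- con (+ 0)) refl m

Den-⊛-trinomial-suc : ∀ (d : ℕ → ℕ) → (∀ n → d (suc n) ≡ suc (suc (d n))) →
                      ∀ n m → (Den ⊛ (λ n m → trinomialℤ (d n) m)) (suc n) m ≡ + 0
Den-⊛-trinomial-suc d d-suc n m = begin
  (Den ⊛ (λ n m → trinomialℤ (d n) m)) (suc n) m
    ≡⟨ Den-⊛-suc (λ n m → trinomialℤ (d n) m) n m ⟩
  trinomialℤ (d (suc n)) (m ℤ.- + 2) ℤ.- Q²-coeff (trinomialℤ (d n)) m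
    ≡⟨ cong (λ k → trinomialℤ k (m ℤ.- + 2) ℤ.- Q²-coeff (trinomialℤ (d n)) m) (d-suc n) ⟩
  trinomialℤ (suc (suc (d n))) (m ℤ.- + 2) ℤ.- Q²-coeff (trinomialℤ (d n)) m
    ≡⟨ cong (ℤ._- Q²-coeff (trinomialℤ (d n)) m) (trinomial-suc-suc (d n) m) ⟩
  Q²-coeff (trinomialℤ (d n)) m ℤ.- Q²-coeff (trinomialℤ (d n)) m
    ≡⟨ ℤₚ.+-inverseʳ (Q²-coeff (trinomialℤ (d n)) m) ⟩
  + 0
    ∎
  where open ≡-Reasoning

trinomial-zero-shift : ∀ j m → trinomialℤ 0 (m ℤ.- + j) ≡ (if ⌊ + j ℤ.≟ m ⌋ then + 1 else + 0)
trinomial-zero-shift j m = trans (lift ⌊ m ℤ.- + j ℤ.≟ + 0 ⌋)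
  (cong (λ b → if b then + 1 else + 0) (trans (isYes≗does (m ℤ.- + j ℤ.≟ + 0))
    (trans (does-⇔ (mk⇔ to from) (m ℤ.- + j ℤ.≟ + 0) (+ j ℤ.≟ m)) (sym (isYes≗does (+ j ℤ.≟ m))))))
  where
  open ℤ-Solver.+-*-Solver
  lift : ∀ b → + (if b then 1 else 0) ≡ (if b then + 1 else + 0)
  lift true  = refl
  lift false = refl
  to : m ℤ.- + j ≡ + 0 → + j ≡ m
  to eq = sym (trans (solve 2 (λ m j → m := (m :- j) :+ j) refl m (+ j)) (trans (cong (ℤ._+ + j) eq) (ℤₚ.+-identityˡ (+ j))))
  from : + j ≡ m → m ℤ.- + j ≡ + 0
  from refl = ℤₚ.+-inverseʳ (+ j)

Den-⊛-AHR : ∀ n m → (Den ⊛ (λ n′ m′ → + AHR n′ m′)) n m ≡ coeffP NumR n m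
Den-⊛-AHR n m = trans (⊛-cong Den (λ a b → cong +_ (AHR≡trinomial a b)) n m) (even n)
  where
  even : ∀ n → (Den ⊛ (λ n m → trinomialℤ (n ℕ.+ n) m)) n m ≡ coeffP NumR n m
  even zero    = trans (Den-⊛-zero (λ n m → trinomialℤ (n ℕ.+ n) m) m)
                       (trans (trinomial-zero-shift 2 m) (sym (ℤₚ.+-identityʳ _)))
  even (suc n) = Den-⊛-trinomial-suc (λ n → n ℕ.+ n) (λ n → cong suc (ℕₚ.+-suc n n)) n m

Den-⊛-AH : ∀ n m → (Den ⊛ (λ n′ m′ → + AH n′ m′)) n m ≡ coeffP NumA n m
Den-⊛-AH n m = trans (⊛-cong Den (λ a b → cong +_ (AH≡trinomial a b)) n m) (odd n)
  where
  open ℤ-Solver.+-*-Solver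
  [_≡m] : ℕ → ℤ
  [ j ≡m] = if ⌊ + j ℤ.≟ m ⌋ then + 1 else + 0
  odd : ∀ n → (Den ⊛ (λ n m → trinomialℤ (suc (n ℕ.+ n)) m)) n m ≡ coeffP NumA n m
  odd zero    = begin
    (Den ⊛ (λ n m → trinomialℤ (suc (n ℕ.+ n)) m)) zero m
      ≡⟨ Den-⊛-zero (λ n m → trinomialℤ (suc (n ℕ.+ n)) m) m ⟩
    trinomialℤ 0 (ℤ.pred (m ℤ.- + 2)) ℤ.+ trinomialℤ 0 (m ℤ.- + 2) ℤ.+ trinomialℤ 0 (ℤ.suc (m ℤ.- + 2))
      ≡⟨ cong₂ ℤ._+_ (cong₂ ℤ._+_ (trans (cong (trinomialℤ 0) (pred-minus-2 m)) (trinomial-zero-shift 3 m))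
                                  (trinomial-zero-shift 2 m))
                     (trans (cong (trinomialℤ 0) (suc-minus-2 m)) (trinomial-zero-shift 1 m)) ⟩
    [ 3 ≡m] ℤ.+ [ 2 ≡m] ℤ.+ [ 1 ≡m]
      ≡⟨ solve 3 (λ a b c → c :+ b :+ a := a :+ (b :+ (c :+ con (+ 0)))) refl [ 1 ≡m] [ 2 ≡m] [ 3 ≡m] ⟩
    coeffP NumA zero m
      ∎
    where open ≡-Reasoning
  odd (suc n) = Den-⊛-trinomial-suc (λ n → suc (n ℕ.+ n)) (λ n → cong (suc ∘ suc) (ℕₚ.+-suc n n)) n m

GFR0-AHR : ∀ n → (+ AHR n (+ 0)) / 1 ≡ GFR0 n
GFR0-AHR n = trans (cong (λ k → (+ k) / 1) (AHR≡trinomial n (+ 0))) (sym (GFR0≗𝔼 n))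

GFA0-AH : ∀ n → (+ AH n (+ 0)) / 1 ≡ GFA0 n
GFA0-AH n = trans (cong (λ k → (+ k) / 1) (AH≡trinomial n (+ 0))) (sym (GFA0≗𝕆 n))

theorem9 : ((n : ℕ) (m : ℤ) → (Den ⊛ (λ n' m' → + AHR n' m')) n m ≡ coeffP NumR n m)
         × ((n : ℕ) (m : ℤ) → (Den ⊛ (λ n' m' → + AH n' m')) n m ≡ coeffP NumA n m)
         × ((n : ℕ) → (+ AHR n (+ 0)) / 1 ≡ GFR0 n)
         × ((n : ℕ) → (+ AH n (+ 0)) / 1 ≡ GFA0 n)
theorem9 = Den-⊛-AHR , Den-⊛-AH , GFR0-AHR , GFA0-AH
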